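{- If $\alpha\in\mathcal O_K$ is negative, there are exactly two greedy Laurent series $\alpha_1,\alpha_2\in\mathcal O_\theta^+$ in its Cauchy class; in particular $\pi(\alpha)=\pi(\alpha_1)=\pi(\alpha_2)$.
   Context: $\theta>1$ is a real quadratic unit with $N(\theta)=-1$, so $\theta^2=a\theta+1$ with an integer $a\ge1$; $K=\mathbb Q(\theta)\subset\mathbb R$, $\mathcal O_K$ its ring of integers. A greedy polynomial is a finite sum $\sum_{i=m}^M b_i\theta^i$ with $b_i\in\{0,\dots,a\}$ such that $b_i=a$ implies $b_{i-1}=0$; every nonzero $\alpha\in\mathcal O_K$ is uniquely $\pm$ such a sum with $b_m\ne0$, and $|\alpha|_\theta:=\theta^{ -m}$, $|0|_\theta=0$. $\widehat{\mathcal O}_\theta$ is the ring of sequences in $\mathcal O_K$ that are Cauchy for $|\cdot|_\theta$ modulo those with $|f_n|_\theta\to0$; $\mathcal O_K\subset\widehat{\mathcal O}_\theta$ via constant sequences, and the Cauchy class of $\alpha\in\mathcal O_K$ is $\pi(\alpha)$. $\mathcal O_\theta^+$ is the set of greedy Laurent series $x=\sum_{i\ge m}b_i\theta^i$ (formal series with $b_i\in\{0,\dots,a\}$ all of whose truncations are greedy polynomials). A sequence $(x_n)$ in $\mathcal O_K$ is a sequence of partial sums of $x$ if there are integers $M_n$, nondecreasing, $M_n\to\infty$, with $x_n=\sum_{i=m}^{M_n}b_i\theta^i+\delta_n$, $\delta_n$ a greedy polynomial involving only powers $\theta^j$, $j>M_n$. All such sequences are Cauchy and define the same class $\pi(x)\in\widehat{\mathcal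 O}_\theta$ (the Cauchy class of $x$). -}

module Defs where

open import Data.Nat as ℕ using (ℕ; zero; suc)
open import Data.Integer as ℤ using (ℤ; +_; -[1+_]; _+_; _*_; -_; _-_; _<_; _≤_)
open import Data.Product using (Σ; ∃; _×_; _,_)
open import Data.Sum using (_⊎_)
open import Data.Unit using (⊤)
open import Data.List using (List; []; _∷_; map; upTo)
open import Relation.Binary.PropositionalEquality using (_≡_)
open import Relation.Nullary using (¬_)

-- Throughout, a : ℕ is the parameter with θ² = aθ + 1 (a ≥ 1 is a hypothesis
-- of the theorem).  θ = (a + √(a²+4))/2 > 1.

-- Elements p + qθ of ℤ[θ] (= the ring O_K of the paper).
record Zθ : Set where
  constructor mk
  field
    re : ℤ
    im : ℤ
open Zθ public

0θ : Zθ
0θ = mk (+ 0) (+ 0)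

1θ : Zθ
1θ = mk (+ 1) (+ 0)

addθ : Zθ → Zθ → Zθ
addθ (mk p q) (mk r s) = mk (p + r) (q + s)

negθ : Zθ → Zθ
negθ (mk p q) = mk (- p) (- q)

subθ : Zθ → Zθ → Zθ
subθ x y = addθ x (negθ y)

-- (p + qθ)(r + sθ) = (pr + qs) + (ps + qr + a qs) θ   using θ² = aθ + 1
mulθ : ℕ → Zθ → Zθ → Zθ
mulθ a (mk p q) (mk r s) = mk (p * r + q * s) (p * s + q * r + (+ a) * q * s)

-- θ itself and θ⁻¹ = θ - a
θ̂ : Zθ
θ̂ = mk (+ 0) (+ 1)

θ⁻¹ : ℕ → Zθ
θ⁻¹ a = mk (- (+ a)) (+ 1)

powθ : ℕ → Zθ → ℕ → Zθ
powθ a x zero = 1θ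
powθ a x (suc n) = mulθ a x (powθ a x n)

θ^ : ℕ → ℤ → Zθ
θ^ a (+ n) = powθ a θ̂ n
θ^ a -[1+ n ] = powθ a (θ⁻¹ a) (suc n)

digitθ : ℕ → Zθ
digitθ d = mk (+ d) (+ 0)

-- α = p + qθ is negative as a real number.  With u = 2p + aq, v = q,
-- D = a² + 4 we have 2α = u + v√D, and (√D being irrational):
Negative : ℕ → Zθ → Set
Negative a (mk p q) =
  (u < + 0 × (v ≤ + 0 ⊎ D * v * v < u * u))
  ⊎ (+ 0 ≤ u × v < + 0 × u * u < D * v * v)
  where
    u = (+ 2) * p + (+ a) * q
    v = q
    D = (+ a) * (+ a) + (+ 4)

-- Digit lists d₀ d₁ … (d_j the coefficient of θ^(m+j)) satisfying the greedy
-- condition: every digit ≤ a, and a digit equal to a is preceded by 0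
-- (the coefficient below the lowest index is 0).
GreedyFrom : ℕ → ℕ → List ℕ → Set
GreedyFrom a prev [] = ⊤
GreedyFrom a prev (d ∷ ds) = (d ℕ.≤ a) × (d ≡ a → prev ≡ 0) × GreedyFrom a d ds

GreedyDigits : ℕ → List ℕ → Set
GreedyDigits a ds = GreedyFrom a 0 ds

polyVal : ℕ → ℤ → List ℕ → Zθ
polyVal a m [] = 0θ
polyVal a m (d ∷ ds) = addθ (mulθ a (digitθ d) (θ^ a m)) (polyVal a (m + + 1) ds)

-- |β|_θ ≤ θ^(-k): β is 0 or ± a greedy polynomial involving only powers θ^j with
-- j ≥ k.  (By uniqueness of greedy expansions this is exactly the condition that
-- the lowest index of the greedy expansion of β is ≥ k.)
AbsLe : ℕ → Zθ → ℤ → Set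
AbsLe a β k =
  Σ ℤ λ m → Σ (List ℕ) λ ds →
    k ≤ m × GreedyDigits a ds × (β ≡ polyVal a m ds ⊎ β ≡ negθ (polyVal a m ds))

-- Greedy Laurent series Σ_{i ≥ start} coeff i θ^i.
record GLS (a : ℕ) : Set where
  field
    coeff  : ℤ → ℕ
    start  : ℤ
    below  : ∀ i → i < start → coeff i ≡ 0
    digit  : ∀ i → coeff i ℕ.≤ a
    greedy : ∀ i → coeff i ≡ a → coeff (i - + 1) ≡ 0
open GLS public

SameSeries : {a : ℕ} → GLS a → GLS a → Set
SameSeries x y = ∀ i → coeff x i ≡ coeff y i

partialSum : {a : ℕ} → GLS a → ℕ → Zθ
partialSum {a} x L = polyVal a (start x) (map (λ j → coeff x (start x + + j)) (upTo L))

-- π(x) = π(α): the sequence of partial sums of x minus α tends to 0 in |·|_θ.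
InClass : {a : ℕ} → GLS a → Zθ → Set
InClass {a} x α = ∀ (k : ℤ) → Σ ℕ λ N → ∀ n → N ℕ.≤ n → AbsLe a (subθ (partialSum x n) α) k

-- Let σ be the Galois conjugation θ ↦ -1/θ.
--
-- Existence: choose J with θ^J > -α and expand α + θ^J greedily downwards from
-- θ^J. The expansion stops, because θ^u times a remainder is an integer z ∈ [0,1)
-- whose conjugate is bounded, and the only such lattice points are 0 and 1/θ.
-- Appending the digits 0, a, 0, a, … at θ^J, θ^(J+1), … adds θ^(J+2v) - θ^J,
-- so every partial sum is α + θ^j or α + θ^(j-1): it converges to α θ-adically.
-- Doing this for J and J + 1 gives two series differing at θ^(J+1).
--
-- Uniqueness: if the partial sums Sₙ of a greedy series converge to α, then
-- r = θ^(-j)(α - Sₙ) lies in (-1 - θ⁻², 0) and σr in (-1 - θ⁻², θ + θ⁻²), which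
-- forces r ∈ {-1, -1/θ}; so Sₙ again overshoots α by θ^j or θ^(j-1). Greedy
-- series whose sums overshoot α and agree at one index agree everywhere, and at a
-- common large index the sums of y, α₁, α₂ take only two values.

module Submission where

open import Defs
open import Data.Nat using (ℕ; _≤_)
open import Data.Product using (Σ; _×_)
open import Data.Sum using (_⊎_)
open import Relation.Nullary using (¬_)

open import Data.Nat as ℕ using (zero; suc; z≤n; s≤s)
import Data.Nat.Properties as ℕ
open import Data.Integer as ℤ using (ℤ; +_; -[1+_]; _+_; _*_; -_; _-_; _⊓_; +<+; +≤+; -<-; -<+)
import Data.Integer.Properties as ℤ
open import Data.Integer.Tactic.RingSolver using (solve-∀)
open import Data.List using (List; []; _∷_; applyUpTo)
open import Data.List.Properties using (map-upTo)
open import Data.Maybe using (Maybe; just; nothing)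
open import Data.Product using (∃-syntax; _,_; proj₁; proj₂)
open import Data.Sum as Sum using (inj₁; inj₂; [_,_]′)
open import Data.Unit using (tt)
open import Data.Empty using (⊥-elim)
open import Level using (0ℓ)
open import Relation.Nullary using (yes; no)
open import Relation.Binary.Definitions using (tri<; tri≈; tri>)
open import Relation.Binary.PropositionalEquality
open import Algebra.Bundles using (CommutativeRing)
open import Algebra.Structures using (IsCommutativeRing)
open import Algebra.Consequences.Propositional using (comm∧idˡ⇒id; comm∧invˡ⇒inv; comm∧distrˡ⇒distrʳ)
open import Algebra.Properties.CommutativeSemigroup using (x∙yz≈y∙xz)
import Algebra.Properties.Ring as RingProperties
import Tactic.RingSolver.Core.AlmostCommutativeRing as ACR
import Tactic.RingSolver.NonReflective as NonReflective

module QuadraticIntegers (a : ℕ) where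

  A : ℤ
  A = + a

  infixl 6 _+'_ _-'_
  infixl 7 _*'_
  infix  8 -'_

  _+'_ _-'_ _*'_ : Zθ → Zθ → Zθ
  _+'_ = addθ
  _-'_ = subθ
  -- Same as mulθ a, but with A as the last factor, so that products of closed
  -- constants reduce (ℕ multiplication recurses on its first argument) and the
  -- ring solver can normalise them.
  mk p q *' mk r s = mk (p * r + q * s) (p * s + q * r + q * s * A)

  -'_ : Zθ → Zθ
  -'_ = negθ

  mulθ≡*' : ∀ x y → mulθ a x y ≡ x *' y
  mulθ≡*' (mk p q) (mk r s) = cong (mk _) (reorder A p q r s)
    where
    reorder : ∀ A p q r s → p * s + q * r + A * q * s ≡ p * s + q * r + q * s * A
    reorder = solve-∀

  fromℤ : ℤ → Zθ
  fromℤ c = mk c (+ 0)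

  θ 1/θ : Zθ
  θ   = θ̂
  1/θ = θ⁻¹ a

  +'-assoc : ∀ x y z → (x +' y) +' z ≡ x +' (y +' z)
  +'-assoc (mk p q) (mk r s) (mk t u) = cong₂ mk (ℤ.+-assoc p r t) (ℤ.+-assoc q s u)

  +'-comm : ∀ x y → x +' y ≡ y +' x
  +'-comm (mk p q) (mk r s) = cong₂ mk (ℤ.+-comm p r) (ℤ.+-comm q s)

  +'-identityˡ : ∀ x → 0θ +' x ≡ x
  +'-identityˡ (mk p q) = cong₂ mk (ℤ.+-identityˡ p) (ℤ.+-identityˡ q)

  -'-inverseˡ : ∀ x → -' x +' x ≡ 0θ
  -'-inverseˡ (mk p q) = cong₂ mk (ℤ.+-inverseˡ p) (ℤ.+-inverseˡ q)

  -'-involutive : ∀ x → -' -' x ≡ x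
  -'-involutive (mk p q) = cong₂ mk (ℤ.neg-involutive p) (ℤ.neg-involutive q)

  *'-comm : ∀ x y → x *' y ≡ y *' x
  *'-comm (mk p q) (mk r s) = cong₂ mk (re-comm p q r s) (im-comm A p q r s)
    where
    re-comm : ∀ p q r s → p * r + q * s ≡ r * p + s * q
    re-comm = solve-∀
    im-comm : ∀ A p q r s → p * s + q * r + q * s * A ≡ r * q + s * p + s * q * A
    im-comm = solve-∀

  *'-assoc : ∀ x y z → (x *' y) *' z ≡ x *' (y *' z)
  *'-assoc (mk p q) (mk r s) (mk t u) = cong₂ mk (re-assoc A p q r s t u) (im-assoc A p q r s t u)
    where
    re-assoc : ∀ A p q r s t u →
      (p * r + q * s) * t + (p * s + q * r + q * s * A) * u ≡ p * (r * t + s * u) + q * (r * u + s * t + s * u * A)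
    re-assoc = solve-∀
    im-assoc : ∀ A p q r s t u →
      (p * r + q * s) * u + (p * s + q * r + q * s * A) * t + (p * s + q * r + q * s * A) * u * A
        ≡ p * (r * u + s * t + s * u * A) + q * (r * t + s * u) + q * (r * u + s * t + s * u * A) * A
    im-assoc = solve-∀

  *'-identityˡ : ∀ x → 1θ *' x ≡ x
  *'-identityˡ (mk p q) = cong₂ mk (re-id p q) (im-id A p q)
    where
    re-id : ∀ p q → + 1 * p + + 0 * q ≡ p
    re-id = solve-∀
    im-id : ∀ A p q → + 1 * q + + 0 * p + + 0 * q * A ≡ q
    im-id = solve-∀

  *'-distribˡ-+' : ∀ x y z → x *' (y +' z) ≡ x *' y +' x *' z
  *'-distribˡ-+' (mk p q) (mk r s) (mk t u) = cong₂ mk (re-distrib p q r s t u) (im-distrib A p q r s t u)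
    where
    re-distrib : ∀ p q r s t u → p * (r + t) + q * (s + u) ≡ (p * r + q * s) + (p * t + q * u)
    re-distrib = solve-∀
    im-distrib : ∀ A p q r s t u →
      p * (s + u) + q * (r + t) + q * (s + u) * A ≡ (p * s + q * r + q * s * A) + (p * u + q * t + q * u * A)
    im-distrib = solve-∀

  isCommutativeRing : IsCommutativeRing _≡_ _+'_ _*'_ -'_ 0θ 1θ
  isCommutativeRing = record
    { isRing = record
      { +-isAbelianGroup = record
        { isGroup = record
          { isMonoid = record
            { isSemigroup = record
              { isMagma = record { isEquivalence = isEquivalence ; ∙-cong = cong₂ _+'_ }
              ; assoc = +'-assoc }
            ; identity = comm∧idˡ⇒id +'-comm +'-identityˡ }
          ; inverse = comm∧invˡ⇒inv +'-comm -'-inverseˡ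
          ; ⁻¹-cong = cong negθ }
        ; comm = +'-comm }
      ; *-cong = cong₂ _*'_
      ; *-assoc = *'-assoc
      ; *-identity = comm∧idˡ⇒id *'-comm *'-identityˡ
      ; distrib = *'-distribˡ-+' , comm∧distrˡ⇒distrʳ *'-comm *'-distribˡ-+' }
    ; *-comm = *'-comm }

  commutativeRing : CommutativeRing 0ℓ 0ℓ
  commutativeRing = record { isCommutativeRing = isCommutativeRing }

  ℤ[θ] : ACR.AlmostCommutativeRing 0ℓ 0ℓ
  ℤ[θ] = ACR.fromCommutativeRing commutativeRing is-0θ
    where
    is-0θ : ∀ x → Maybe (0θ ≡ x)
    is-0θ (mk (+ zero) (+ zero)) = just refl
    is-0θ _                      = nothing

  open NonReflective ℤ[θ] public using (solve; _⊜_; _⊕_; _⊗_; ⊝_; Κ)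

  open CommutativeRing commutativeRing public
    using () renaming (*-identityʳ to *'-identityʳ; +-identityʳ to +'-identityʳ; zeroʳ to *'-zeroʳ; zeroˡ to *'-zeroˡ;
                       -‿inverseʳ to -'-inverseʳ; distribʳ to *'-distribʳ-+')
  open RingProperties (CommutativeRing.ring commutativeRing) public
    using () renaming (-‿distribˡ-* to -'-distribˡ-*'; -‿distribʳ-* to -'-distribʳ-*')

  x*[y*z]≡y*[x*z] : ∀ x y z → x *' (y *' z) ≡ y *' (x *' z)
  x*[y*z]≡y*[x*z] = x∙yz≈y∙xz (CommutativeRing.*-commutativeSemigroup commutativeRing)

  θ*1/θ : θ *' 1/θ ≡ 1θ
  θ*1/θ = cong₂ mk refl (im-eq A)
    where
    im-eq : ∀ A → + 0 * + 1 + + 1 * - A + + 1 * + 1 * A ≡ + 0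
    im-eq = solve-∀

  θ≡A+1/θ : θ ≡ fromℤ A +' 1/θ
  θ≡A+1/θ = cong₂ mk (sym (ℤ.+-inverseʳ A)) refl

  1/θ*θ : 1/θ *' θ ≡ 1θ
  1/θ*θ = trans (*'-comm 1/θ θ) θ*1/θ

  θ*θ : θ *' θ ≡ fromℤ A *' θ +' 1θ
  θ*θ = cong₂ mk (re-eq A) (im-eq A)
    where
    re-eq : ∀ A → + 0 * + 0 + + 1 * + 1 ≡ A * + 0 + + 0 * + 1 + + 1
    re-eq = solve-∀
    im-eq : ∀ A → + 0 * + 1 + + 1 * + 0 + + 1 * + 1 * A ≡ A * + 1 + + 0 * + 0 + + 0 * + 1 * A + + 0
    im-eq = solve-∀

  pow : ℤ → Zθ
  pow = θ^ a

  pow-suc : ∀ i → pow (i + + 1) ≡ θ *' pow i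
  pow-suc (+ n)            = trans (cong (powθ a θ) (ℕ.+-comm n 1)) (mulθ≡*' θ (pow (+ n)))
  pow-suc -[1+ zero ]      = sym (begin
    θ *' mulθ a 1/θ 1θ  ≡⟨ cong (θ *'_) (trans (mulθ≡*' 1/θ 1θ) (*'-identityʳ 1/θ)) ⟩
    θ *' 1/θ            ≡⟨ θ*1/θ ⟩
    1θ                  ∎)
    where open ≡-Reasoning
  pow-suc -[1+ suc n ]     = sym (begin
    θ *' pow -[1+ suc n ]        ≡⟨ cong (θ *'_) (mulθ≡*' 1/θ (pow -[1+ n ])) ⟩
    θ *' (1/θ *' pow -[1+ n ])  ≡⟨ *'-assoc θ 1/θ _ ⟨
    (θ *' 1/θ) *' pow -[1+ n ]  ≡⟨ cong (_*' pow -[1+ n ]) θ*1/θ ⟩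
    1θ *' pow -[1+ n ]          ≡⟨ *'-identityˡ _ ⟩
    pow -[1+ n ]                ∎)
    where open ≡-Reasoning

  1/θ*[θ*x] : ∀ x → 1/θ *' (θ *' x) ≡ x
  1/θ*[θ*x] x = trans (sym (*'-assoc 1/θ θ x)) (trans (cong (_*' x) 1/θ*θ) (*'-identityˡ x))

  pow-pred : ∀ i → pow (i - + 1) ≡ 1/θ *' pow i
  pow-pred i = begin
    pow (i - + 1)                  ≡⟨ 1/θ*[θ*x] _ ⟨
    1/θ *' (θ *' pow (i - + 1))    ≡⟨ cong (1/θ *'_) (pow-suc (i - + 1)) ⟨
    1/θ *' pow (i - + 1 + + 1)     ≡⟨ cong (λ j → 1/θ *' pow j) (i-1+1≡i i) ⟩
    1/θ *' pow i                   ∎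
    where
    open ≡-Reasoning
    i-1+1≡i : ∀ i → i - + 1 + + 1 ≡ i
    i-1+1≡i = solve-∀

  pow-+ : ∀ i j → pow (i + j) ≡ pow i *' pow j
  pow-+ i (+ zero) = trans (cong pow (ℤ.+-identityʳ i)) (sym (*'-identityʳ (pow i)))
  pow-+ i (+ suc n) = begin
    pow (i + + suc n)              ≡⟨ cong pow (shift i (+ n)) ⟩
    pow (i + + n + + 1)            ≡⟨ pow-suc (i + + n) ⟩
    θ *' pow (i + + n)             ≡⟨ cong (θ *'_) (pow-+ i (+ n)) ⟩
    θ *' (pow i *' pow (+ n))      ≡⟨ x*[y*z]≡y*[x*z] θ (pow i) (pow (+ n)) ⟩
    pow i *' (θ *' pow (+ n))      ≡⟨ cong (pow i *'_) (mulθ≡*' θ (pow (+ n))) ⟨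
    pow i *' pow (+ suc n)         ∎
    where
    open ≡-Reasoning
    shift : ∀ i n → i + (+ 1 + n) ≡ i + n + + 1
    shift = solve-∀
  pow-+ i -[1+ zero ] = trans (pow-pred i) (trans (*'-comm 1/θ (pow i)) (cong (pow i *'_) (sym (trans (mulθ≡*' 1/θ 1θ) (*'-identityʳ 1/θ)))))
  pow-+ i -[1+ suc n ] = begin
    pow (i + -[1+ suc n ])            ≡⟨ cong pow (shift i (+ n)) ⟩
    pow (i + -[1+ n ] - + 1)          ≡⟨ pow-pred (i + -[1+ n ]) ⟩
    1/θ *' pow (i + -[1+ n ])         ≡⟨ cong (1/θ *'_) (pow-+ i -[1+ n ]) ⟩
    1/θ *' (pow i *' pow -[1+ n ])    ≡⟨ x*[y*z]≡y*[x*z] 1/θ (pow i) (pow -[1+ n ]) ⟩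
    pow i *' (1/θ *' pow -[1+ n ])    ≡⟨ cong (pow i *'_) (mulθ≡*' 1/θ (pow -[1+ n ])) ⟨
    pow i *' pow -[1+ suc n ]         ∎
    where
    open ≡-Reasoning
    shift : ∀ i n → i - (+ 1 + (+ 1 + n)) ≡ i - (+ 1 + n) - + 1
    shift = solve-∀

  pow-inverse : ∀ i → pow (- i) *' pow i ≡ 1θ
  pow-inverse i = trans (sym (pow-+ (- i) i)) (cong pow (ℤ.+-inverseˡ i))

  pow-recurrence : ∀ k → pow (k + + 1) ≡ fromℤ A *' pow k +' pow (k - + 1)
  pow-recurrence k = begin
    pow (k + + 1)                          ≡⟨ cong pow (k+1≡k-1+1+1 k) ⟩
    pow (k - + 1 + + 1 + + 1)              ≡⟨ pow-suc (k - + 1 + + 1) ⟩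
    θ *' pow (k - + 1 + + 1)               ≡⟨ cong (θ *'_) (pow-suc (k - + 1)) ⟩
    θ *' (θ *' pow (k - + 1))              ≡⟨ *'-assoc θ θ (pow (k - + 1)) ⟨
    (θ *' θ) *' pow (k - + 1)              ≡⟨ cong (_*' pow (k - + 1)) θ*θ ⟩
    (fromℤ A *' θ +' 1θ) *' pow (k - + 1)  ≡⟨ expand (fromℤ A) θ (pow (k - + 1)) ⟩
    fromℤ A *' (θ *' pow (k - + 1)) +' pow (k - + 1)   ≡⟨ cong (λ y → fromℤ A *' y +' pow (k - + 1)) (pow-suc (k - + 1)) ⟨
    fromℤ A *' pow (k - + 1 + + 1) +' pow (k - + 1)    ≡⟨ cong (λ j → fromℤ A *' pow j +' pow (k - + 1)) (k-1+1≡k k) ⟩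
    fromℤ A *' pow k +' pow (k - + 1)      ∎
    where
    open ≡-Reasoning
    k+1≡k-1+1+1 : ∀ k → k + + 1 ≡ k - + 1 + + 1 + + 1
    k+1≡k-1+1+1 = solve-∀
    k-1+1≡k : ∀ k → k - + 1 + + 1 ≡ k
    k-1+1≡k = solve-∀
    expand : ∀ c t x → (c *' t +' 1θ) *' x ≡ c *' (t *' x) +' x
    expand = solve 3 (λ c t x → (c ⊗ t ⊕ Κ 1θ) ⊗ x ⊜ (c ⊗ (t ⊗ x) ⊕ x)) refl

  -- The Galois conjugation θ ↦ a - θ = -1/θ.
  σ : Zθ → Zθ
  σ (mk p q) = mk (p + q * A) (- q)

  σ-+ : ∀ x y → σ (x +' y) ≡ σ x +' σ y
  σ-+ (mk p q) (mk r s) = cong₂ mk (re-eq A p q r s) (ℤ.neg-distrib-+ q s)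
    where
    re-eq : ∀ A p q r s → p + r + (q + s) * A ≡ p + q * A + (r + s * A)
    re-eq = solve-∀

  σ-neg : ∀ x → σ (-' x) ≡ -' σ x
  σ-neg (mk p q) = cong₂ mk (re-eq A p q) refl
    where
    re-eq : ∀ A p q → - p + - q * A ≡ - (p + q * A)
    re-eq = solve-∀

  σ-sub : ∀ x y → σ (x -' y) ≡ σ x -' σ y
  σ-sub x y = trans (σ-+ x (-' y)) (cong (σ x +'_) (σ-neg y))

  σ-* : ∀ x y → σ (x *' y) ≡ σ x *' σ y
  σ-* (mk p q) (mk r s) = cong₂ mk (re-eq A p q r s) (im-eq A p q r s)
    where
    re-eq : ∀ A p q r s → p * r + q * s + (p * s + q * r + q * s * A) * A ≡ (p + q * A) * (r + s * A) + (- q) * (- s)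
    re-eq = solve-∀
    im-eq : ∀ A p q r s → - (p * s + q * r + q * s * A) ≡ (p + q * A) * (- s) + (- q) * (r + s * A) + (- q) * (- s) * A
    im-eq = solve-∀

  σ-fromℤ : ∀ c → σ (fromℤ c) ≡ fromℤ c
  σ-fromℤ c = cong₂ mk (ℤ.+-identityʳ c) refl

  σ-θ : σ θ ≡ -' 1/θ
  σ-θ = cong₂ mk (re-eq A) refl
    where
    re-eq : ∀ A → + 0 + + 1 * A ≡ - - A
    re-eq = solve-∀

  value : List ℕ → Zθ
  value []       = 0θ
  value (d ∷ ds) = fromℤ (+ d) +' θ *' value ds

  polyVal≡pow*value : ∀ m ds → polyVal a m ds ≡ pow m *' value ds
  polyVal≡pow*value m []       = sym (*'-zeroʳ (pow m))
  polyVal≡pow*value m (d ∷ ds) = begin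
    mulθ a (fromℤ (+ d)) (pow m) +' polyVal a (m + + 1) ds  ≡⟨ cong₂ _+'_ (mulθ≡*' (fromℤ (+ d)) (pow m)) (polyVal≡pow*value (m + + 1) ds) ⟩
    fromℤ (+ d) *' pow m +' pow (m + + 1) *' value ds       ≡⟨ cong (λ y → fromℤ (+ d) *' pow m +' y *' value ds) (pow-suc m) ⟩
    fromℤ (+ d) *' pow m +' θ *' pow m *' value ds          ≡⟨ factor (fromℤ (+ d)) (pow m) θ (value ds) ⟩
    pow m *' value (d ∷ ds)                                 ∎
    where
    open ≡-Reasoning
    factor : ∀ c p t v → c *' p +' t *' p *' v ≡ p *' (c +' t *' v)
    factor = solve 4 (λ c p t v → c ⊗ p ⊕ t ⊗ p ⊗ v ⊜ p ⊗ (c ⊕ t ⊗ v)) refl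

module Positivity (a : ℕ) (1≤a : 1 ℕ.≤ a) where
  open QuadraticIntegers a

  private
    0<A : + 0 ℤ.< A
    0<A = +<+ 1≤a

    0≤i*j : ∀ {i j} → + 0 ℤ.≤ i → + 0 ℤ.≤ j → + 0 ℤ.≤ i * j
    0≤i*j {+ m} {+ n} _ _ = subst (+ 0 ℤ.≤_) (ℤ.pos-* m n) (+≤+ z≤n)

    0<i*j : ∀ {i j} → + 0 ℤ.< i → + 0 ℤ.< j → + 0 ℤ.< i * j
    0<i*j {+ suc m} {+ suc n} _ _ = +<+ (s≤s z≤n)
    0<i*j {+ zero} (+<+ ())
    0<i*j {+ suc m} {+ zero} _ (+<+ ())

  PositiveCoords : Zθ → Set
  PositiveCoords (mk p q) = (+ 0 ℤ.≤ p) × (+ 0 ℤ.≤ q) × (+ 0 ℤ.< p ⊎ + 0 ℤ.< q)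

  θ*mk : ∀ p q → θ *' mk p q ≡ mk q (p + q * A)
  θ*mk p q = cong₂ mk (re-eq p q) (im-eq A p q)
    where
    re-eq : ∀ p q → + 0 * p + + 1 * q ≡ q
    re-eq = solve-∀
    im-eq : ∀ A p q → + 0 * q + + 1 * p + + 1 * q * A ≡ p + q * A
    im-eq = solve-∀

  PositiveCoords-θ* : ∀ {x} → PositiveCoords x → PositiveCoords (θ *' x)
  PositiveCoords-θ* {mk p q} (0≤p , 0≤q , p>0∨q>0) = subst PositiveCoords (sym (θ*mk p q))
    (0≤q , ℤ.+-mono-≤ 0≤p 0≤qA , [ (λ p>0 → inj₂ (ℤ.+-mono-<-≤ p>0 0≤qA)) , inj₁ ]′ p>0∨q>0)
    where
    0≤qA : + 0 ℤ.≤ q * A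
    0≤qA = 0≤i*j 0≤q (ℤ.<⇒≤ 0<A)

  PositiveCoords-+ : ∀ {x y} → PositiveCoords x → PositiveCoords y → PositiveCoords (x +' y)
  PositiveCoords-+ {mk p q} {mk r s} (0≤p , 0≤q , h) (0≤r , 0≤s , _) =
    ℤ.+-mono-≤ 0≤p 0≤r , ℤ.+-mono-≤ 0≤q 0≤s , Sum.map (λ p>0 → ℤ.+-mono-<-≤ p>0 0≤r) (λ q>0 → ℤ.+-mono-<-≤ q>0 0≤s) h

  PositiveCoords-fromℤ* : ∀ {c x} → + 0 ℤ.< c → PositiveCoords x → PositiveCoords (fromℤ c *' x)
  PositiveCoords-fromℤ* {c} {mk p q} c>0 (0≤p , 0≤q , h) = subst PositiveCoords (sym (cong₂ mk (re-eq c p q) (im-eq A c p q)))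
    (0≤i*j (ℤ.<⇒≤ c>0) 0≤p , 0≤i*j (ℤ.<⇒≤ c>0) 0≤q , Sum.map (0<i*j c>0) (0<i*j c>0) h)
    where
    re-eq : ∀ c p q → c * p + + 0 * q ≡ c * p
    re-eq = solve-∀
    im-eq : ∀ A c p q → c * q + + 0 * p + + 0 * q * A ≡ c * q
    im-eq = solve-∀

  ¬PositiveCoords-0 : ¬ PositiveCoords 0θ
  ¬PositiveCoords-0 (_ , _ , inj₁ (+<+ ()))
  ¬PositiveCoords-0 (_ , _ , inj₂ (+<+ ()))

  PositiveCoords-asym : ∀ {x} → PositiveCoords x → ¬ PositiveCoords (-' x)
  PositiveCoords-asym {mk p q} (_ , _ , inj₁ p>0) (-p≥0 , _ , _) = ℤ.<-irrefl refl (ℤ.<-≤-trans p>0 (ℤ.neg-cancel-≤ -p≥0))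
  PositiveCoords-asym {mk p q} (_ , _ , inj₂ q>0) (_ , -q≥0 , _) = ℤ.<-irrefl refl (ℤ.<-≤-trans q>0 (ℤ.neg-cancel-≤ -q≥0))

  -- The conjugate of θⁿx tends to 0, so for large n the coordinates of θⁿx
  -- are nonnegative iff x > 0.
  record Positive (x : Zθ) : Set where
    constructor positive
    field
      exponent : ℕ
      coords   : PositiveCoords (pow (+ exponent) *' x)

  NonNegative : Zθ → Set
  NonNegative x = Positive x ⊎ x ≡ 0θ

  pow-suc*x : ∀ n x → pow (+ suc n) *' x ≡ θ *' (pow (+ n) *' x)
  pow-suc*x n x = trans (cong (_*' x) (mulθ≡*' θ (pow (+ n)))) (*'-assoc θ (pow (+ n)) x)

  positive-as : ∀ {x y} → x ≡ y → Positive y → Positive x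
  positive-as refl h = h

  Positive-coords : ∀ {x} → PositiveCoords x → Positive x
  Positive-coords {x} h = positive 0 (subst PositiveCoords (sym (*'-identityˡ x)) h)

  PositiveCoords-pow*-mono : ∀ k {n x} → PositiveCoords (pow (+ n) *' x) → PositiveCoords (pow (+ (k ℕ.+ n)) *' x)
  PositiveCoords-pow*-mono zero    h = h
  PositiveCoords-pow*-mono (suc k) {n} {x} h = subst PositiveCoords (sym (pow-suc*x (k ℕ.+ n) x)) (PositiveCoords-θ* (PositiveCoords-pow*-mono k h))

  Positive-+ : ∀ {x y} → Positive x → Positive y → Positive (x +' y)
  Positive-+ {x} {y} (positive n hx) (positive m hy) = positive (m ℕ.+ n)
    (subst PositiveCoords (sym (*'-distribˡ-+' (pow (+ (m ℕ.+ n))) x y))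
      (PositiveCoords-+ (PositiveCoords-pow*-mono m hx) (subst (λ k → PositiveCoords (pow (+ k) *' y)) (ℕ.+-comm n m) (PositiveCoords-pow*-mono n hy))))

  Positive-θ* : ∀ {x} → Positive x → Positive (θ *' x)
  Positive-θ* {x} (positive n h) = positive n (subst PositiveCoords (x*[y*z]≡y*[x*z] θ (pow (+ n)) x) (PositiveCoords-θ* h))


  Positive-θ*⁻ : ∀ {x} → Positive (θ *' x) → Positive x
  Positive-θ*⁻ {x} (positive n h) = positive (suc n) (subst PositiveCoords (sym (trans (pow-suc*x n x) (x*[y*z]≡y*[x*z] θ (pow (+ n)) x))) h)


  Positive-1/θ* : ∀ {x} → Positive x → Positive (1/θ *' x)
  Positive-1/θ* {x} (positive n h) = positive (suc n) (subst PositiveCoords (sym e) h)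
    where
    cancel : ∀ t u p x → t *' u ≡ 1θ → t *' (p *' (u *' x)) ≡ p *' x
    cancel t u p x tu≡1 = begin
      t *' (p *' (u *' x))  ≡⟨ solve 4 (λ t u p x → t ⊗ (p ⊗ (u ⊗ x)) ⊜ p ⊗ ((t ⊗ u) ⊗ x)) refl t u p x ⟩
      p *' ((t *' u) *' x)  ≡⟨ cong (λ y → p *' (y *' x)) tu≡1 ⟩
      p *' (1θ *' x)        ≡⟨ cong (p *'_) (*'-identityˡ x) ⟩
      p *' x                ∎
      where open ≡-Reasoning
    e : pow (+ suc n) *' (1/θ *' x) ≡ pow (+ n) *' x
    e = trans (pow-suc*x n (1/θ *' x)) (cancel θ 1/θ (pow (+ n)) x θ*1/θ)

  Positive-fromℤ* : ∀ {c x} → + 0 ℤ.< c → Positive x → Positive (fromℤ c *' x)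
  Positive-fromℤ* {c} {x} c>0 (positive n h) =
    positive n (subst PositiveCoords (x*[y*z]≡y*[x*z] (fromℤ c) (pow (+ n)) x) (PositiveCoords-fromℤ* c>0 h))


  Positive-powθ* : ∀ {y} → (∀ {z} → Positive z → Positive (y *' z)) → ∀ n {x} → Positive x → Positive (powθ a y n *' x)
  Positive-powθ* step zero    {x} h = positive-as (*'-identityˡ x) h
  Positive-powθ* {y} step (suc n) {x} h =
    positive-as (trans (cong (_*' x) (mulθ≡*' y (powθ a y n))) (*'-assoc y _ x)) (step (Positive-powθ* step n h))

  Positive-pow* : ∀ i {x} → Positive x → Positive (pow i *' x)
  Positive-pow* (+ n)    = Positive-powθ* {θ} Positive-θ* n
  Positive-pow* -[1+ n ] = Positive-powθ* {1/θ} Positive-1/θ* (suc n)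

  Positive-1 : Positive 1θ
  Positive-1 = Positive-coords (+≤+ z≤n , +≤+ z≤n , inj₁ (+<+ (s≤s z≤n)))

  Positive-pow : ∀ i → Positive (pow i)
  Positive-pow i = positive-as (sym (*'-identityʳ (pow i))) (Positive-pow* i Positive-1)

  Positive-θ : Positive θ
  Positive-θ = Positive-coords (+≤+ z≤n , +≤+ z≤n , inj₂ (+<+ (s≤s z≤n)))

  Positive-1/θ : Positive 1/θ
  Positive-1/θ = positive-as (sym (*'-identityʳ 1/θ)) (Positive-1/θ* Positive-1)

  ¬Positive-0 : ¬ Positive 0θ
  ¬Positive-0 (positive n h) = ¬PositiveCoords-0 (subst PositiveCoords (*'-zeroʳ (pow (+ n))) h)

  Positive-asym : ∀ {x} → Positive x → ¬ Positive (-' x)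
  Positive-asym {x} (positive n hx) (positive m h-x) = PositiveCoords-asym (PositiveCoords-pow*-mono m hx)
    (subst PositiveCoords (sym (-'-distribʳ-*' (pow (+ (m ℕ.+ n))) x))
      (subst (λ k → PositiveCoords (pow (+ k) *' -' x)) (ℕ.+-comm n m) (PositiveCoords-pow*-mono n h-x)))

  Positive⇒¬NonNegative-neg : ∀ {x} → Positive x → ¬ NonNegative (-' x)
  Positive⇒¬NonNegative-neg     x>0 (inj₁ -x>0)  = Positive-asym x>0 -x>0
  Positive⇒¬NonNegative-neg {x} x>0 (inj₂ -x≡0) = ¬Positive-0 (subst Positive (trans (sym (-'-involutive x)) (cong -'_ -x≡0)) x>0)

  Trichotomous : Zθ → Set
  Trichotomous x = Positive x ⊎ x ≡ 0θ ⊎ Positive (-' x)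

  trichotomous-θ*⁻ : ∀ x → Trichotomous (θ *' x) → Trichotomous x
  trichotomous-θ*⁻ x (inj₁ θx>0)        = inj₁ (Positive-θ*⁻ θx>0)
  trichotomous-θ*⁻ x (inj₂ (inj₁ θx≡0)) = inj₂ (inj₁ (begin
    x                 ≡⟨ 1/θ*[θ*x] x ⟨
    1/θ *' (θ *' x)   ≡⟨ cong (1/θ *'_) θx≡0 ⟩
    1/θ *' 0θ         ≡⟨ *'-zeroʳ 1/θ ⟩
    0θ                ∎))
    where open ≡-Reasoning
  trichotomous-θ*⁻ x (inj₂ (inj₂ θx<0)) = inj₂ (inj₂ (Positive-θ*⁻ (positive-as (sym (-'-distribʳ-*' θ x)) θx<0)))

  -- For p < 0 < q, θ(p + qθ) = q + (p + qA)θ with p < p + qA, so either its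
  -- coordinates are nonnegative or they have opposite signs and |q| + |p + qA|
  -- < |p| + |q|; this descent terminates.
  trichotomous-by-descent : ∀ n p q → ℤ.∣ p ∣ ℕ.+ ℤ.∣ q ∣ ℕ.< n → Trichotomous (mk p q)
  trichotomous-by-descent (suc n) (+ zero)  (+ zero)   _ = inj₂ (inj₁ refl)
  trichotomous-by-descent (suc n) (+ zero)  (+ suc k)  _ = inj₁ (Positive-coords (+≤+ z≤n , +≤+ z≤n , inj₂ (+<+ (s≤s z≤n))))
  trichotomous-by-descent (suc n) (+ suc m) (+ k)      _ = inj₁ (Positive-coords (+≤+ z≤n , +≤+ z≤n , inj₁ (+<+ (s≤s z≤n))))
  trichotomous-by-descent (suc n) -[1+ m ]  -[1+ k ]   _ = inj₂ (inj₂ (Positive-coords (+≤+ z≤n , +≤+ z≤n , inj₁ (+<+ (s≤s z≤n)))))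
  trichotomous-by-descent (suc n) -[1+ m ]  (+ zero)   _ = inj₂ (inj₂ (Positive-coords (+≤+ z≤n , +≤+ z≤n , inj₁ (+<+ (s≤s z≤n)))))
  trichotomous-by-descent (suc n) (+ zero)  -[1+ k ]   _ = inj₂ (inj₂ (Positive-coords (+≤+ z≤n , +≤+ z≤n , inj₂ (+<+ (s≤s z≤n)))))
  trichotomous-by-descent (suc n) -[1+ m ] (+ suc k) bound with -[1+ m ] + + suc k * A in eq
  ... | + j = trichotomous-θ*⁻ _ (inj₁ (Positive-coords
    (subst PositiveCoords (sym (trans (θ*mk -[1+ m ] (+ suc k)) (cong (mk (+ suc k)) eq))) (+≤+ z≤n , +≤+ z≤n , inj₁ (+<+ (s≤s z≤n))))))
  ... | -[1+ m′ ] = trichotomous-θ*⁻ _ (subst Trichotomous (sym (trans (θ*mk -[1+ m ] (+ suc k)) (cong (mk (+ suc k)) eq)))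
    (trichotomous-by-descent n (+ suc k) -[1+ m′ ] (ℕ.<-≤-trans smaller (ℕ.≤-pred bound))))
    where
    increased : -[1+ m ] ℤ.< -[1+ m′ ]
    increased = subst₂ ℤ._<_ (ℤ.+-identityʳ _) eq (ℤ.+-monoʳ-< -[1+ m ] (0<i*j {+ suc k} (+<+ (s≤s z≤n)) 0<A))
    m′<m : m′ ℕ.< m
    m′<m with increased
    ... | -<- m′<m = m′<m
    smaller : suc k ℕ.+ suc m′ ℕ.< suc m ℕ.+ suc k
    smaller = subst (suc k ℕ.+ suc m′ ℕ.<_) (ℕ.+-comm (suc k) (suc m)) (ℕ.+-monoʳ-< (suc k) (s≤s m′<m))
  trichotomous-by-descent (suc n) (+ suc m) -[1+ k ] bound with + suc m + -[1+ k ] * A in eq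
  ... | -[1+ j ] = trichotomous-θ*⁻ _ (inj₂ (inj₂ (Positive-coords
    (subst PositiveCoords (sym (cong -'_ (trans (θ*mk (+ suc m) -[1+ k ]) (cong (mk -[1+ k ]) eq)))) (+≤+ z≤n , +≤+ z≤n , inj₁ (+<+ (s≤s z≤n)))))))
  ... | + zero = trichotomous-θ*⁻ _ (inj₂ (inj₂ (Positive-coords
    (subst PositiveCoords (sym (cong -'_ (trans (θ*mk (+ suc m) -[1+ k ]) (cong (mk -[1+ k ]) eq)))) (+≤+ z≤n , +≤+ z≤n , inj₁ (+<+ (s≤s z≤n)))))))
  ... | + suc m′ = trichotomous-θ*⁻ _ (subst Trichotomous (sym (trans (θ*mk (+ suc m) -[1+ k ]) (cong (mk -[1+ k ]) eq)))
    (trichotomous-by-descent n -[1+ k ] (+ suc m′) (ℕ.<-≤-trans smaller (ℕ.≤-pred bound))))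
    where
    -[1+k]*A<0 : -[1+ k ] * A ℤ.< + 0
    -[1+k]*A<0 = subst (ℤ._< + 0) (ℤ.neg-distribˡ-* (+ suc k) A) (ℤ.neg-mono-< (0<i*j {+ suc k} (+<+ (s≤s z≤n)) 0<A))
    decreased : + suc m′ ℤ.< + suc m
    decreased = subst₂ ℤ._<_ eq (ℤ.+-identityʳ _) (ℤ.+-monoʳ-< (+ suc m) -[1+k]*A<0)
    m′<m : m′ ℕ.< m
    m′<m with decreased
    ... | +<+ (s≤s m′<m) = m′<m
    smaller : suc k ℕ.+ suc m′ ℕ.< suc m ℕ.+ suc k
    smaller = subst (suc k ℕ.+ suc m′ ℕ.<_) (ℕ.+-comm (suc k) (suc m)) (ℕ.+-monoʳ-< (suc k) (s≤s m′<m))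

  trichotomy : ∀ x → Trichotomous x
  trichotomy (mk p q) = trichotomous-by-descent _ p q ℕ.≤-refl

  nonNegative⊎negative : ∀ x → NonNegative x ⊎ Positive (-' x)
  nonNegative⊎negative x with trichotomy x
  ... | inj₁ x>0        = inj₁ (inj₁ x>0)
  ... | inj₂ (inj₁ x≡0) = inj₁ (inj₂ x≡0)
  ... | inj₂ (inj₂ x<0) = inj₂ x<0

  NonNegative-+-Positive : ∀ {x y} → NonNegative x → Positive y → Positive (x +' y)
  NonNegative-+-Positive (inj₁ x>0)  y>0 = Positive-+ x>0 y>0
  NonNegative-+-Positive (inj₂ refl) y>0 = positive-as (+'-identityˡ _) y>0

  NonNegative-pow* : ∀ i {x} → NonNegative x → NonNegative (pow i *' x)
  NonNegative-pow* i (inj₁ x>0)  = inj₁ (Positive-pow* i x>0)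
  NonNegative-pow* i (inj₂ refl) = inj₂ (*'-zeroʳ (pow i))

  NonNegative-θ* : ∀ {x} → NonNegative x → NonNegative (θ *' x)
  NonNegative-θ* (inj₁ x>0)  = inj₁ (Positive-θ* x>0)
  NonNegative-θ* (inj₂ refl) = inj₂ (*'-zeroʳ θ)

  NonNegative-1/θ* : ∀ {x} → NonNegative x → NonNegative (1/θ *' x)
  NonNegative-1/θ* (inj₁ x>0)  = inj₁ (Positive-1/θ* x>0)
  NonNegative-1/θ* (inj₂ refl) = inj₂ (*'-zeroʳ 1/θ)

  Positive-fromℤ : ∀ {c} → + 0 ℤ.< c → Positive (fromℤ c)
  Positive-fromℤ c>0 = Positive-coords (ℤ.<⇒≤ c>0 , ℤ.≤-refl , inj₁ c>0)

  NonNegative-fromℤ : ∀ {c} → + 0 ℤ.≤ c → NonNegative (fromℤ c)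
  NonNegative-fromℤ {+ zero}  _ = inj₂ refl
  NonNegative-fromℤ {+ suc n} _ = inj₁ (Positive-fromℤ (+<+ (s≤s z≤n)))

  Positive-fromℤ⁻ : ∀ {c} → Positive (fromℤ c) → + 0 ℤ.< c
  Positive-fromℤ⁻ {+ zero}   c>0 = ⊥-elim (¬Positive-0 c>0)
  Positive-fromℤ⁻ {+ suc n}  _   = +<+ (s≤s z≤n)
  Positive-fromℤ⁻ { -[1+ n ]} c>0 = ⊥-elim (Positive-asym c>0 (Positive-fromℤ (+<+ (s≤s z≤n))))

  Positive-fromℤ*⁻ : ∀ {c w} → Positive (fromℤ c *' w) → Positive w → + 0 ℤ.< c
  Positive-fromℤ*⁻ {+ zero}   {w} cw>0 _   = ⊥-elim (¬Positive-0 (positive-as (sym (*'-zeroˡ w)) cw>0))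
  Positive-fromℤ*⁻ {+ suc n}      _    _   = +<+ (s≤s z≤n)
  Positive-fromℤ*⁻ { -[1+ n ]} {w} cw>0 w>0 =
    ⊥-elim (Positive-asym cw>0 (positive-as (neg-neg (fromℤ (+ suc n)) w) (Positive-fromℤ* {+ suc n} (+<+ (s≤s z≤n)) w>0)))
    where
    neg-neg : ∀ c w → -' (-' c *' w) ≡ c *' w
    neg-neg = solve 2 (λ c w → ⊝ (⊝ c ⊗ w) ⊜ c ⊗ w) refl

  Positive+NonNegative≢0 : ∀ {x y} → Positive x → NonNegative y → x +' y ≢ 0θ
  Positive+NonNegative≢0 {x} {y} x>0 y≥0 x+y≡0 =
    ¬Positive-0 (subst Positive x+y≡0 (subst Positive (+'-comm y x) (NonNegative-+-Positive y≥0 x>0)))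

  1/θ² : Zθ
  1/θ² = 1/θ *' 1/θ

  Positive-θ-1 : Positive (θ -' 1θ)
  Positive-θ-1 = positive-as (trans (cong (_-' 1θ) θ≡A+1/θ) (regroup (fromℤ A) 1/θ))
    (NonNegative-+-Positive (NonNegative-fromℤ (ℤ.i≤j⇒0≤j-i (+≤+ 1≤a))) Positive-1/θ)
    where
    regroup : ∀ c t → c +' t -' 1θ ≡ (c -' 1θ) +' t
    regroup = solve 2 (λ c t → c ⊕ t ⊕ ⊝ Κ 1θ ⊜ ((c ⊕ ⊝ Κ 1θ) ⊕ t)) refl

  Positive-1-1/θ : Positive (1θ -' 1/θ)
  Positive-1-1/θ = positive-as (trans (cong (_-' 1/θ) (sym 1/θ*θ)) (factor 1/θ θ)) (Positive-1/θ* Positive-θ-1)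
    where
    factor : ∀ u t → u *' t -' u ≡ u *' (t -' 1θ)
    factor = solve 2 (λ u t → u ⊗ t ⊕ ⊝ u ⊜ u ⊗ (t ⊕ ⊝ Κ 1θ)) refl

  Positive-1/θ-1/θ² : Positive (1/θ -' 1/θ²)
  Positive-1/θ-1/θ² = positive-as (factor 1/θ) (Positive-1/θ* Positive-1-1/θ)
    where
    factor : ∀ u → u -' u *' u ≡ u *' (1θ -' u)
    factor = solve 1 (λ u → u ⊕ ⊝ (u ⊗ u) ⊜ u ⊗ (Κ 1θ ⊕ ⊝ u)) refl

  Positive-1-1/θ² : Positive (1θ -' 1/θ²)
  Positive-1-1/θ² = positive-as (telescope 1/θ) (Positive-+ Positive-1-1/θ Positive-1/θ-1/θ²)
    where
    telescope : ∀ u → 1θ -' u *' u ≡ (1θ -' u) +' (u -' u *' u)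
    telescope = solve 1 (λ u → Κ 1θ ⊕ ⊝ (u ⊗ u) ⊜ ((Κ 1θ ⊕ ⊝ u) ⊕ (u ⊕ ⊝ (u ⊗ u)))) refl

  1≤pow : ∀ n → NonNegative (pow (+ n) -' 1θ)
  1≤pow zero    = inj₂ (-'-inverseʳ 1θ)
  1≤pow (suc n) = inj₁ (positive-as (trans (cong (_-' 1θ) (mulθ≡*' θ (pow (+ n)))) (regroup θ (pow (+ n))))
                          (NonNegative-+-Positive (NonNegative-θ* (1≤pow n)) Positive-θ-1))
    where
    regroup : ∀ t p → t *' p -' 1θ ≡ t *' (p -' 1θ) +' (t -' 1θ)
    regroup = solve 2 (λ t p → t ⊗ p ⊕ ⊝ Κ 1θ ⊜ (t ⊗ (p ⊕ ⊝ Κ 1θ) ⊕ (t ⊕ ⊝ Κ 1θ))) refl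

  pow-mono : ∀ i n → NonNegative (pow (i + + n) -' pow i)
  pow-mono i n = subst NonNegative (sym (trans (cong (_-' pow i) (pow-+ i (+ n))) (factor (pow i) (pow (+ n)))))
    (NonNegative-pow* i (1≤pow n))
    where
    factor : ∀ x y → x *' y -' x ≡ x *' (y -' 1θ)
    factor = solve 2 (λ x y → x ⊗ y ⊕ ⊝ x ⊜ x ⊗ (y ⊕ ⊝ Κ 1θ)) refl

  powCoords : ℕ → ℕ × ℕ
  powCoords zero    = 1 , 0
  powCoords (suc c) = proj₂ (powCoords c) , proj₁ (powCoords c) ℕ.+ proj₂ (powCoords c) ℕ.* a

  pow≡mk-powCoords : ∀ c → pow (+ c) ≡ mk (+ proj₁ (powCoords c)) (+ proj₂ (powCoords c))
  pow≡mk-powCoords zero    = refl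
  pow≡mk-powCoords (suc c) = begin
    pow (+ suc c)              ≡⟨ mulθ≡*' θ (pow (+ c)) ⟩
    θ *' pow (+ c)             ≡⟨ cong (θ *'_) (pow≡mk-powCoords c) ⟩
    θ *' mk (+ P) (+ Q)        ≡⟨ θ*mk (+ P) (+ Q) ⟩
    mk (+ Q) (+ P + + Q * A)   ≡⟨ cong (mk (+ Q)) (trans (cong (ℤ._+_ (+ P)) (sym (ℤ.pos-* Q a))) (sym (ℤ.pos-+ P (Q ℕ.* a)))) ⟩
    mk (+ Q) (+ (P ℕ.+ Q ℕ.* a)) ∎
    where
    open ≡-Reasoning
    P Q : ℕ
    P = proj₁ (powCoords c)
    Q = proj₂ (powCoords c)

  i<j⇒0<j-i : ∀ {i j} → i ℤ.< j → + 0 ℤ.< j - i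
  i<j⇒0<j-i {i} {j} i<j = subst (ℤ._< j - i) (ℤ.+-inverseʳ i) (ℤ.+-monoˡ-< (- i) i<j)

  private
    Q : ℕ → ℕ
    Q c = proj₂ (powCoords c)

    Q-mono : ∀ c → Q c ℕ.≤ Q (suc c)
    Q-mono c = ℕ.≤-trans (ℕ.≤-reflexive (sym (ℕ.*-identityʳ (Q c))))
                 (ℕ.≤-trans (ℕ.*-monoʳ-≤ (Q c) 1≤a) (ℕ.m≤n+m _ (proj₁ (powCoords c))))

    Q-pos : ∀ c → 1 ℕ.≤ Q (suc c)
    Q-pos zero    = ℕ.≤-refl
    Q-pos (suc c) = ℕ.≤-trans (Q-pos c) (Q-mono (suc c))

    Q-grows : ∀ c → c ℕ.≤ Q (suc c)
    Q-grows zero          = z≤n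
    Q-grows (suc zero)    = ℕ.≤-trans 1≤a (ℕ.≤-reflexive (sym (ℕ.*-identityˡ a)))
    Q-grows (suc (suc c)) = ℕ.+-mono-≤ (Q-pos c)
      (ℕ.≤-trans (Q-grows (suc c)) (ℕ.≤-trans (ℕ.≤-reflexive (sym (ℕ.*-identityʳ _))) (ℕ.*-monoʳ-≤ (Q (suc (suc c))) 1≤a)))

    ∣i∣<n⇒-n<i<n : ∀ i n → ℤ.∣ i ∣ ℕ.< n → (+ 0 ℤ.< + n - i) × (+ 0 ℤ.< + n + i)
    ∣i∣<n⇒-n<i<n (+ m)    n m<n = i<j⇒0<j-i (+<+ m<n) , ℤ.+-mono-<-≤ (+<+ (ℕ.≤-<-trans z≤n m<n)) (+≤+ z≤n)
    ∣i∣<n⇒-n<i<n -[1+ m ] n m<n = ℤ.+-mono-<-≤ (+<+ (ℕ.≤-<-trans z≤n m<n)) (+≤+ z≤n) , i<j⇒0<j-i (+<+ m<n)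

  archimedean : ∀ x → ∃[ c ] Positive (pow (+ c) -' x) × Positive (pow (+ c) +' x)
  archimedean (mk p q) = c , x<θ^c , -θ^c<x
    where
    N c : ℕ
    N = ℤ.∣ p ∣ ℕ.+ ℤ.∣ q ∣
    c = suc (suc (suc N))
    p-bounds : (+ 0 ℤ.< + proj₁ (powCoords c) - p) × (+ 0 ℤ.< + proj₁ (powCoords c) + p)
    p-bounds = ∣i∣<n⇒-n<i<n p (proj₁ (powCoords c)) (ℕ.<-≤-trans (s≤s (ℕ.m≤m+n _ _)) (Q-grows (suc N)))
    q-bounds : (+ 0 ℤ.< + Q c - q) × (+ 0 ℤ.< + Q c + q)
    q-bounds = ∣i∣<n⇒-n<i<n q (Q c) (ℕ.<-≤-trans (s≤s (ℕ.≤-trans (ℕ.m≤n+m _ _) (ℕ.n≤1+n _))) (Q-grows (suc (suc N))))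
    x<θ^c : Positive (pow (+ c) -' mk p q)
    x<θ^c = positive-as (cong (_-' mk p q) (pow≡mk-powCoords c))
      (Positive-coords (ℤ.<⇒≤ (proj₁ p-bounds) , ℤ.<⇒≤ (proj₁ q-bounds) , inj₁ (proj₁ p-bounds)))
    -θ^c<x : Positive (pow (+ c) +' mk p q)
    -θ^c<x = positive-as (cong (_+' mk p q) (pow≡mk-powCoords c))
      (Positive-coords (ℤ.<⇒≤ (proj₂ p-bounds) , ℤ.<⇒≤ (proj₂ q-bounds) , inj₁ (proj₂ p-bounds)))

  norm : ℤ → ℤ → ℤ
  norm P Q = P * P + P * Q * A - Q * Q

  -- Sufficient conditions for P + Qθ > 0: nonnegative coordinates, or opposite
  -- signs with the norm (P + Qθ)(P - Q/θ) of the sign that makes the conjugate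
  -- P - Q/θ the negative factor.
  PositiveByNorm : ℤ → ℤ → Set
  PositiveByNorm P Q = PositiveCoords (mk P Q)
    ⊎ (P ℤ.< + 0 × + 0 ℤ.< Q × norm P Q ℤ.< + 0)
    ⊎ (Q ℤ.< + 0 × + 0 ℤ.< P × + 0 ℤ.< norm P Q)

  private
    0≤i*i : ∀ i → + 0 ℤ.≤ i * i
    0≤i*i (+ n)    = 0≤i*j {+ n} {+ n} (+≤+ z≤n) (+≤+ z≤n)
    0≤i*i -[1+ n ] = subst (+ 0 ℤ.≤_) (square-neg (+ suc n)) (0≤i*j {+ suc n} {+ suc n} (+≤+ z≤n) (+≤+ z≤n))
      where
      square-neg : ∀ i → i * i ≡ (- i) * (- i)
      square-neg = solve-∀

    positive+nonNegative≢0 : ∀ i j k → + 0 ℤ.< i → + 0 ℤ.≤ j → + 0 ℤ.≤ k → i + j + k ≢ + 0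
    positive+nonNegative≢0 i j k i>0 j≥0 k≥0 i+j+k≡0 =
      ℤ.<-irrefl refl (subst (+ 0 ℤ.<_) i+j+k≡0 (ℤ.+-mono-<-≤ (ℤ.+-mono-<-≤ i>0 j≥0) k≥0))

    norm-θ* : ∀ P Q → norm Q (P + Q * A) ≡ - norm P Q
    norm-θ* P Q = norm-eq A P Q
      where
      norm-eq : ∀ A P Q → Q * Q + Q * (P + Q * A) * A - (P + Q * A) * (P + Q * A) ≡ - (P * P + P * Q * A - Q * Q)
      norm-eq = solve-∀

    norm-split : ∀ P Q → norm P Q + Q * Q + (- P) * (P + Q * A) ≡ + 0
    norm-split P Q = split-eq A P Q
      where
      split-eq : ∀ A P Q → (P * P + P * Q * A - Q * Q) + Q * Q + (- P) * (P + Q * A) ≡ + 0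
      split-eq = solve-∀

  PositiveByNorm-θ* : ∀ P Q → PositiveByNorm P Q → PositiveByNorm Q (P + Q * A)
  PositiveByNorm-θ* P Q (inj₁ h) = inj₁ (subst PositiveCoords (θ*mk P Q) (PositiveCoords-θ* h))
  PositiveByNorm-θ* P Q (inj₂ (inj₁ (P<0 , Q>0 , N<0))) with ℤ.<-cmp (P + Q * A) (+ 0)
  ... | tri< P+QA<0 _ _ = inj₂ (inj₂ (P+QA<0 , Q>0 , subst (+ 0 ℤ.<_) (sym (norm-θ* P Q)) (ℤ.neg-mono-< N<0)))
  ... | tri≈ _ P+QA≡0 _ = inj₁ (ℤ.<⇒≤ Q>0 , ℤ.≤-reflexive (sym P+QA≡0) , inj₁ Q>0)
  ... | tri> _ _ P+QA>0 = inj₁ (ℤ.<⇒≤ Q>0 , ℤ.<⇒≤ P+QA>0 , inj₁ Q>0)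
  PositiveByNorm-θ* P Q (inj₂ (inj₂ (Q<0 , P>0 , N>0))) = inj₂ (inj₁ (Q<0 , P+QA>0 , subst (ℤ._< + 0) (sym (norm-θ* P Q)) (ℤ.neg-mono-< N>0)))
    where
    -- N(P + Qθ) = P(P + QA) - Q², so P + QA ≤ 0 would make the norm nonpositive.
    P+QA>0 : + 0 ℤ.< P + Q * A
    P+QA>0 with ℤ.<-cmp (+ 0) (P + Q * A)
    ... | tri< 0<P+QA _ _ = 0<P+QA
    ... | tri≈ _ 0≡P+QA _ = ⊥-elim (positive+nonNegative≢0 (norm P Q) (Q * Q) ((- P) * (P + Q * A)) N>0 (0≤i*i Q)
                                       (subst (λ y → + 0 ℤ.≤ (- P) * y) 0≡P+QA (ℤ.≤-reflexive (sym (ℤ.*-zeroʳ (- P))))) (norm-split P Q))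
    ... | tri> _ _ P+QA<0 = ⊥-elim (positive+nonNegative≢0 (norm P Q) (Q * Q) ((- P) * (P + Q * A)) N>0 (0≤i*i Q)
                                       (neg*neg { - P} (ℤ.neg-mono-< P>0) P+QA<0) (norm-split P Q))
      where
      neg*neg : ∀ {i j} → i ℤ.< + 0 → j ℤ.< + 0 → + 0 ℤ.≤ i * j
      neg*neg {i} {j} i<0 j<0 = subst (+ 0 ℤ.≤_) (neg-eq i j) (0≤i*j (ℤ.<⇒≤ (ℤ.neg-mono-< i<0)) (ℤ.<⇒≤ (ℤ.neg-mono-< j<0)))
        where
        neg-eq : ∀ i j → (- i) * (- j) ≡ i * j
        neg-eq = solve-∀

  PositiveByNorm-pow* : ∀ n P Q → PositiveByNorm P Q →
    ∃[ P′ ] ∃[ Q′ ] pow (+ n) *' mk P Q ≡ mk P′ Q′ × PositiveByNorm P′ Q′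
  PositiveByNorm-pow* zero    P Q h = P , Q , *'-identityˡ (mk P Q) , h
  PositiveByNorm-pow* (suc n) P Q h with PositiveByNorm-pow* n P Q h
  ... | P′ , Q′ , e , h′ = Q′ , P′ + Q′ * A , trans (pow-suc*x n (mk P Q)) (trans (cong (θ *'_) e) (θ*mk P′ Q′)) , PositiveByNorm-θ* P′ Q′ h′

  PositiveByNorm⇒¬PositiveCoords-neg : ∀ P Q → PositiveByNorm P Q → ¬ PositiveCoords (-' mk P Q)
  PositiveByNorm⇒¬PositiveCoords-neg P Q (inj₁ h)                   = PositiveCoords-asym h
  PositiveByNorm⇒¬PositiveCoords-neg P Q (inj₂ (inj₁ (_ , Q>0 , _))) (_ , -Q≥0 , _) = ℤ.<-irrefl refl (ℤ.<-≤-trans Q>0 (ℤ.neg-cancel-≤ -Q≥0))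
  PositiveByNorm⇒¬PositiveCoords-neg P Q (inj₂ (inj₂ (_ , P>0 , _))) (-P≥0 , _ , _) = ℤ.<-irrefl refl (ℤ.<-≤-trans P>0 (ℤ.neg-cancel-≤ -P≥0))

  PositiveByNorm⇒≢0 : ∀ P Q → PositiveByNorm P Q → mk P Q ≢ 0θ
  PositiveByNorm⇒≢0 P Q (inj₁ h)                     refl = ¬PositiveCoords-0 h
  PositiveByNorm⇒≢0 P Q (inj₂ (inj₁ (P<0 , _ , _))) refl = ℤ.<-irrefl refl P<0
  PositiveByNorm⇒≢0 P Q (inj₂ (inj₂ (Q<0 , _ , _))) refl = ℤ.<-irrefl refl Q<0

  PositiveByNorm⇒Positive : ∀ P Q → PositiveByNorm P Q → Positive (mk P Q)
  PositiveByNorm⇒Positive P Q h with trichotomy (mk P Q)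
  ... | inj₁ x>0        = x>0
  ... | inj₂ (inj₁ x≡0) = ⊥-elim (PositiveByNorm⇒≢0 P Q h x≡0)
  ... | inj₂ (inj₂ (positive n h-x)) with PositiveByNorm-pow* n P Q h
  ...   | P′ , Q′ , e , h′ = ⊥-elim (PositiveByNorm⇒¬PositiveCoords-neg P′ Q′ h′
            (subst PositiveCoords (trans (sym (-'-distribʳ-*' (pow (+ n)) (mk P Q))) (cong -'_ e)) h-x))

  private
    u : ℤ → ℤ → ℤ
    u p q = + 2 * p + A * q

    D : ℤ
    D = A * A + + 4

    4*norm-neg : ∀ p q → + 4 * norm (- p) (- q) ≡ u p q * u p q - D * q * q
    4*norm-neg p q = eq A p q
      where
      eq : ∀ A p q → + 4 * ((- p) * (- p) + (- p) * (- q) * A - (- q) * (- q)) ≡ (+ 2 * p + A * q) * (+ 2 * p + A * q) - (A * A + + 4) * q * q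
      eq = solve-∀

    0<4*i⇒0<i : ∀ {i} → + 0 ℤ.< + 4 * i → + 0 ℤ.< i
    0<4*i⇒0<i {+ zero}   (+<+ ())
    0<4*i⇒0<i {+ suc n}  _ = +<+ (s≤s z≤n)
    0<4*i⇒0<i { -[1+ n ]} ()

    4*i<0⇒i<0 : ∀ {i} → + 4 * i ℤ.< + 0 → i ℤ.< + 0
    4*i<0⇒i<0 {+ zero}   (+<+ ())
    4*i<0⇒i<0 {+ suc n}  (+<+ ())
    4*i<0⇒i<0 { -[1+ n ]} _ = -<+

    0≤p⇒0<q⇒0<u : ∀ {p q} → + 0 ℤ.≤ p → + 0 ℤ.< q → + 0 ℤ.< u p q
    0≤p⇒0<q⇒0<u {p} {q} 0≤p 0<q = ℤ.+-mono-≤-< (0≤i*j {+ 2} {p} (+≤+ z≤n) 0≤p) (0<i*j 0<A 0<q)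

    p≤0⇒q<0⇒u<0 : ∀ {p q} → p ℤ.≤ + 0 → q ℤ.< + 0 → u p q ℤ.< + 0
    p≤0⇒q<0⇒u<0 {p} {q} p≤0 q<0 =
      ℤ.neg-cancel-< (subst (+ 0 ℤ.<_) (u-neg A p q) (0≤p⇒0<q⇒0<u (ℤ.neg-mono-≤ p≤0) (ℤ.neg-mono-< q<0)))
      where
      u-neg : ∀ A p q → + 2 * (- p) + A * (- q) ≡ - (+ 2 * p + A * q)
      u-neg = solve-∀

    u<0∧q≤0 : ∀ {p q} → u p q ℤ.< + 0 → q ℤ.≤ + 0 → PositiveByNorm (- p) (- q)
    u<0∧q≤0 {p} {q} u<0 q≤0 with ℤ.<-cmp p (+ 0) | ℤ.<-cmp q (+ 0)
    ... | tri< p<0 _ _ | _            = inj₁ (ℤ.<⇒≤ (ℤ.neg-mono-< p<0) , ℤ.neg-mono-≤ q≤0 , inj₁ (ℤ.neg-mono-< p<0))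
    ... | tri≈ _ refl _ | tri< q<0 _ _ = inj₁ (ℤ.≤-refl , ℤ.neg-mono-≤ q≤0 , inj₂ (ℤ.neg-mono-< q<0))
    ... | tri≈ _ refl _ | tri≈ _ refl _ = ⊥-elim (ℤ.<-irrefl (u00 A) u<0)
      where
      u00 : ∀ A → + 2 * + 0 + A * + 0 ≡ + 0
      u00 = solve-∀
    ... | _             | tri> _ _ q>0 = ⊥-elim (ℤ.<-irrefl refl (ℤ.<-≤-trans q>0 q≤0))
    ... | tri> _ _ p>0 | tri≈ _ refl _ = ⊥-elim (ℤ.<-asym u<0 (subst (+ 0 ℤ.<_) (u-p0 A p) (0<i*j {+ 2} (+<+ (s≤s z≤n)) p>0)))
      where
      u-p0 : ∀ A p → + 2 * p ≡ + 2 * p + A * + 0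
      u-p0 = solve-∀
    ... | tri> _ _ p>0 | tri< q<0 _ _ = inj₂ (inj₁ (ℤ.neg-mono-< p>0 , ℤ.neg-mono-< q<0 , N<0))
      where
      -- N(-p - qθ) = -(q² + p·(-(p + qA))) and p + qA = u - p < 0.
      p+qA<0 : p + q * A ℤ.< + 0
      p+qA<0 = subst (ℤ._< + 0) (u-p A p q) (ℤ.+-mono-<-≤ u<0 (ℤ.<⇒≤ (ℤ.neg-mono-< p>0)))
        where
        u-p : ∀ A p q → + 2 * p + A * q + - p ≡ p + q * A
        u-p = solve-∀
      N<0 : norm (- p) (- q) ℤ.< + 0
      N<0 = subst (ℤ._< + 0) (sym (norm-eq A p q))
        (ℤ.neg-mono-< (ℤ.+-mono-≤-< (0≤i*i q) (0<i*j p>0 (ℤ.neg-mono-< p+qA<0))))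
        where
        norm-eq : ∀ A p q → (- p) * (- p) + (- p) * (- q) * A - (- q) * (- q) ≡ - (q * q + p * (- (p + q * A)))
        norm-eq = solve-∀

  -- With u = 2p + Aq and D = A² + 4, four times the norm of -(p + qθ) is
  -- u² - Dq², and Negative compares exactly these two squares.
  Negative⇒PositiveByNorm : ∀ p q → Negative a (mk p q) → PositiveByNorm (- p) (- q)
  Negative⇒PositiveByNorm p q (inj₁ (u<0 , inj₁ q≤0)) = u<0∧q≤0 u<0 q≤0
  Negative⇒PositiveByNorm p q (inj₁ (u<0 , inj₂ Dq²<u²)) with ℤ.<-cmp q (+ 0)
  ... | tri< q<0 _ _ = u<0∧q≤0 u<0 (ℤ.<⇒≤ q<0)
  ... | tri≈ _ q≡0 _ = u<0∧q≤0 u<0 (ℤ.≤-reflexive q≡0)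
  ... | tri> _ _ q>0 = inj₂ (inj₂ (ℤ.neg-mono-< q>0 , ℤ.neg-mono-< p<0 , 0<4*i⇒0<i (subst (+ 0 ℤ.<_) (sym (4*norm-neg p q)) (i<j⇒0<j-i Dq²<u²))))
    where
    p<0 : p ℤ.< + 0
    p<0 = ℤ.≰⇒> (λ p≥0 → ℤ.<-asym u<0 (0≤p⇒0<q⇒0<u p≥0 q>0))
  Negative⇒PositiveByNorm p q (inj₂ (u≥0 , q<0 , u²<Dq²)) =
    inj₂ (inj₁ (ℤ.neg-mono-< p>0 , ℤ.neg-mono-< q<0 , 4*i<0⇒i<0 (subst (ℤ._< + 0) (sym (4*norm-neg p q)) (i<j⇒i-j<0 u²<Dq²))))
    where
    p>0 : + 0 ℤ.< p
    p>0 = ℤ.≰⇒> (λ p≤0 → ℤ.<-irrefl refl (ℤ.<-≤-trans (p≤0⇒q<0⇒u<0 p≤0 q<0) u≥0))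
    i<j⇒i-j<0 : ∀ {i j} → i ℤ.< j → i - j ℤ.< + 0
    i<j⇒i-j<0 {i} {j} i<j = subst (ℤ._< + 0) (neg-eq i j) (ℤ.neg-mono-< (i<j⇒0<j-i i<j))
      where
      neg-eq : ∀ i j → - (j - i) ≡ i - j
      neg-eq = solve-∀

  Negative⇒Positive-neg : ∀ α → Negative a α → Positive (-' α)
  Negative⇒Positive-neg (mk p q) α<0 = PositiveByNorm⇒Positive (- p) (- q) (Negative⇒PositiveByNorm p q α<0)

module GreedySums (a : ℕ) (1≤a : 1 ℕ.≤ a) where
  open QuadraticIntegers a
  open Positivity a 1≤a

  Overshoot : Zθ → ℤ → Zθ → Set
  Overshoot α j x = x ≡ α +' pow j ⊎ x ≡ α +' pow (j - + 1)

  InWindow : Zθ → Set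
  InWindow w = Positive (w +' 1θ) × Positive (θ -' w)

  -- σ(d + θv) = d - σ(v)/θ, so the window (-1, θ) is preserved by prepending a
  -- digit d ≤ a.
  σ-value-inWindow : ∀ prev ds → GreedyFrom a prev ds → InWindow (σ (value ds))
  σ-value-inWindow prev []       _ = Positive-1 , positive-as (cong₂ mk (ℤ.+-identityʳ _) refl) Positive-θ
  σ-value-inWindow prev (d ∷ ds) (d≤a , _ , greedy) = lower , upper
    where
    w : Zθ
    w = σ (value ds)
    w-window : InWindow w
    w-window = σ-value-inWindow d ds greedy
    σ-value : σ (value (d ∷ ds)) ≡ fromℤ (+ d) -' 1/θ *' w
    σ-value = begin
      σ (fromℤ (+ d) +' θ *' value ds)         ≡⟨ σ-+ (fromℤ (+ d)) (θ *' value ds) ⟩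
      σ (fromℤ (+ d)) +' σ (θ *' value ds)     ≡⟨ cong₂ _+'_ (σ-fromℤ (+ d)) (trans (σ-* θ (value ds)) (cong (_*' w) σ-θ)) ⟩
      fromℤ (+ d) +' -' 1/θ *' w               ≡⟨ cong (fromℤ (+ d) +'_) (-'-distribˡ-*' 1/θ w) ⟨
      fromℤ (+ d) -' 1/θ *' w                  ∎
      where open ≡-Reasoning
    lower : Positive (σ (value (d ∷ ds)) +' 1θ)
    lower = positive-as (begin
      σ (value (d ∷ ds)) +' 1θ               ≡⟨ cong (_+' 1θ) σ-value ⟩
      fromℤ (+ d) -' 1/θ *' w +' 1θ          ≡⟨ cong (fromℤ (+ d) -' 1/θ *' w +'_) 1/θ*θ ⟨
      fromℤ (+ d) -' 1/θ *' w +' 1/θ *' θ    ≡⟨ regroup (fromℤ (+ d)) 1/θ w θ ⟩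
      fromℤ (+ d) +' 1/θ *' (θ -' w)         ∎)
      (NonNegative-+-Positive (NonNegative-fromℤ (+≤+ z≤n)) (Positive-1/θ* (proj₂ w-window)))
      where
      open ≡-Reasoning
      regroup : ∀ x u w t → x -' u *' w +' u *' t ≡ x +' u *' (t -' w)
      regroup = solve 4 (λ x u w t → x ⊕ ⊝ (u ⊗ w) ⊕ u ⊗ t ⊜ (x ⊕ u ⊗ (t ⊕ ⊝ w))) refl
    upper : Positive (θ -' σ (value (d ∷ ds)))
    upper = positive-as (begin
      θ -' σ (value (d ∷ ds))                      ≡⟨ cong₂ _-'_ θ≡A+1/θ σ-value ⟩
      (fromℤ A +' 1/θ) -' (fromℤ (+ d) -' 1/θ *' w) ≡⟨ regroup (fromℤ A) 1/θ (fromℤ (+ d)) w ⟩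
      (fromℤ A -' fromℤ (+ d)) +' 1/θ *' (w +' 1θ) ∎)
      (NonNegative-+-Positive (NonNegative-fromℤ (ℤ.i≤j⇒0≤j-i (+≤+ d≤a))) (Positive-1/θ* (proj₁ w-window)))
      where
      open ≡-Reasoning
      regroup : ∀ c u x w → (c +' u) -' (x -' u *' w) ≡ (c -' x) +' u *' (w +' 1θ)
      regroup = solve 4 (λ c u x w → (c ⊕ u) ⊕ ⊝ (x ⊕ ⊝ (u ⊗ w)) ⊜ ((c ⊕ ⊝ x) ⊕ u ⊗ (w ⊕ Κ 1θ))) refl

  digitsFrom : (ℤ → ℕ) → ℤ → ℕ → List ℕ
  digitsFrom f m zero    = []
  digitsFrom f m (suc n) = f m ∷ digitsFrom f (m + + 1) n

  sumFrom : (ℤ → ℕ) → ℤ → ℕ → Zθ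
  sumFrom f m n = polyVal a m (digitsFrom f m n)

  applyUpTo≡digitsFrom : ∀ f m n (g : ℕ → ℕ) → (∀ j → g j ≡ f (m + + j)) → applyUpTo g n ≡ digitsFrom f m n
  applyUpTo≡digitsFrom f m zero    g g≗f = refl
  applyUpTo≡digitsFrom f m (suc n) g g≗f = cong₂ _∷_ (trans (g≗f 0) (cong f (ℤ.+-identityʳ m)))
    (applyUpTo≡digitsFrom f (m + + 1) n (λ j → g (suc j)) (λ j → trans (g≗f (suc j)) (cong f (shift m (+ j)))))
    where
    shift : ∀ m j → m + (+ 1 + j) ≡ m + + 1 + j
    shift = solve-∀

  partialSum≡sumFrom : ∀ (x : GLS a) n → partialSum x n ≡ sumFrom (coeff x) (start x) n
  partialSum≡sumFrom x n = cong (polyVal a (start x))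
    (trans (map-upTo _ n) (applyUpTo≡digitsFrom (coeff x) (start x) n _ (λ j → refl)))

  sumFrom≡pow*value : ∀ f m n → sumFrom f m n ≡ pow m *' value (digitsFrom f m n)
  sumFrom≡pow*value f m n = polyVal≡pow*value m (digitsFrom f m n)

  sumFrom-+ : ∀ f k m n → sumFrom f m (k ℕ.+ n) ≡ sumFrom f m k +' sumFrom f (m + + k) n
  sumFrom-+ f zero    m n = sym (trans (+'-identityˡ _) (cong (λ i → sumFrom f i n) (ℤ.+-identityʳ m)))
  sumFrom-+ f (suc k) m n = begin
    d +' sumFrom f (m + + 1) (k ℕ.+ n)                                  ≡⟨ cong (d +'_) (sumFrom-+ f k (m + + 1) n) ⟩
    d +' (sumFrom f (m + + 1) k +' sumFrom f (m + + 1 + + k) n)         ≡⟨ +'-assoc d _ _ ⟨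
    d +' sumFrom f (m + + 1) k +' sumFrom f (m + + 1 + + k) n           ≡⟨ cong (λ i → d +' sumFrom f (m + + 1) k +' sumFrom f i n) (shift m (+ k)) ⟩
    sumFrom f m (suc k) +' sumFrom f (m + + suc k) n                    ∎
    where
    open ≡-Reasoning
    d : Zθ
    d = mulθ a (digitθ (f m)) (pow m)
    shift : ∀ m k → m + + 1 + k ≡ m + (+ 1 + k)
    shift = solve-∀

  sumFrom-suc : ∀ f m n → sumFrom f m (suc n) ≡ sumFrom f m n +' fromℤ (+ f (m + + n)) *' pow (m + + n)
  sumFrom-suc f m n = begin
    sumFrom f m (suc n)                                      ≡⟨ cong (sumFrom f m) (ℕ.+-comm 1 n) ⟩
    sumFrom f m (n ℕ.+ 1)                                    ≡⟨ sumFrom-+ f n m 1 ⟩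
    sumFrom f m n +' sumFrom f (m + + n) 1                   ≡⟨ cong (sumFrom f m n +'_) (trans (+'-identityʳ _) (mulθ≡*' (fromℤ (+ f (m + + n))) (pow (m + + n)))) ⟩
    sumFrom f m n +' fromℤ (+ f (m + + n)) *' pow (m + + n)  ∎
    where open ≡-Reasoning

  sumFrom-zeros : ∀ f m n → (∀ j → j ℕ.< n → f (m + + j) ≡ 0) → sumFrom f m n ≡ 0θ
  sumFrom-zeros f m zero    _     = refl
  sumFrom-zeros f m (suc n) zeros = begin
    sumFrom f m (suc n)                                      ≡⟨ sumFrom-suc f m n ⟩
    sumFrom f m n +' fromℤ (+ f (m + + n)) *' pow (m + + n)  ≡⟨ cong₂ (λ s d → s +' fromℤ (+ d) *' pow (m + + n))
                                                                  (sumFrom-zeros f m n (λ j j<n → zeros j (ℕ.m<n⇒m<1+n j<n))) (zeros n ℕ.≤-refl) ⟩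
    0θ +' fromℤ (+ 0) *' pow (m + + n)                       ≡⟨ trans (+'-identityˡ _) (*'-zeroˡ (pow (m + + n))) ⟩
    0θ                                                       ∎
    where open ≡-Reasoning

  value-nonNegative : ∀ ds → NonNegative (value ds)
  value-nonNegative []       = inj₂ refl
  value-nonNegative (d ∷ ds) with NonNegative-fromℤ {+ d} (+≤+ z≤n)
  ... | inj₁ d>0  = inj₁ (positive-as (+'-comm (fromℤ (+ d)) (θ *' value ds)) (NonNegative-+-Positive (NonNegative-θ* (value-nonNegative ds)) d>0))
  ... | inj₂ d≡0 = subst NonNegative (sym (trans (cong (_+' θ *' value ds) d≡0) (+'-identityˡ _))) (NonNegative-θ* (value-nonNegative ds))

  sumFrom-nonNegative : ∀ f m n → NonNegative (sumFrom f m n)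
  sumFrom-nonNegative f m n = subst NonNegative (sym (sumFrom≡pow*value f m n)) (NonNegative-pow* m (value-nonNegative (digitsFrom f m n)))

  AbsLe-pow : ∀ {k m} → k ℤ.≤ m → AbsLe a (pow m) k
  AbsLe-pow {k} {m} k≤m = m , 1 ∷ [] , k≤m , (1≤a , (λ _ → refl) , tt) ,
    inj₁ (sym (trans (+'-identityʳ _) (trans (mulθ≡*' (fromℤ (+ 1)) (pow m)) (*'-identityˡ (pow m)))))

  Greedy : (ℤ → ℕ) → Set
  Greedy f = (∀ i → f i ℕ.≤ a) × (∀ i → f i ≡ a → f (i - + 1) ≡ 0)

  digitsFrom-greedy : ∀ f → Greedy f → ∀ n m → GreedyFrom a (f (m - + 1)) (digitsFrom f m n)
  digitsFrom-greedy f greedy zero    m = tt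
  digitsFrom-greedy f greedy (suc n) m = proj₁ greedy m , proj₂ greedy m ,
    subst (λ i → GreedyFrom a (f i) (digitsFrom f (m + + 1) n)) (m+1-1≡m m) (digitsFrom-greedy f greedy n (m + + 1))
    where
    m+1-1≡m : ∀ m → m + + 1 - + 1 ≡ m
    m+1-1≡m = solve-∀

  sumFrom-bounds : ∀ f → Greedy f → ∀ m n →
    Positive (pow (m + + n) -' sumFrom f m n) × (f (m + + n - + 1) ≡ 0 → Positive (pow (m + + n - + 1) -' sumFrom f m n))
  sumFrom-bounds f greedy m zero =
    positive-as (+'-identityʳ _) (Positive-pow (m + + 0)) , λ _ → positive-as (+'-identityʳ _) (Positive-pow (m + + 0 - + 1))
  sumFrom-bounds f greedy m (suc n) = below-next , below-current
    where
    k : ℤ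
    d : ℕ
    s : Zθ
    k = m + + n
    d = f k
    s = sumFrom f m n
    ih : Positive (pow (m + + n) -' s) × (f (m + + n - + 1) ≡ 0 → Positive (pow (m + + n - + 1) -' s))
    ih = sumFrom-bounds f greedy m n
    top≡k+1 : m + + suc n ≡ k + + 1
    top≡k+1 = shift m (+ n)
      where
      shift : ∀ m n → m + (+ 1 + n) ≡ m + n + + 1
      shift = solve-∀
    top-1≡k : m + + suc n - + 1 ≡ k
    top-1≡k = shift m (+ n)
      where
      shift : ∀ m n → m + (+ 1 + n) - + 1 ≡ m + n
      shift = solve-∀
    pow-top : pow (m + + suc n) ≡ fromℤ A *' pow k +' pow (k - + 1)
    pow-top = trans (cong pow top≡k+1) (pow-recurrence k)

    below-current : f (m + + suc n - + 1) ≡ 0 → Positive (pow (m + + suc n - + 1) -' sumFrom f m (suc n))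
    below-current f[top-1]≡0 = positive-as (begin
      pow (m + + suc n - + 1) -' sumFrom f m (suc n)   ≡⟨ cong₂ _-'_ (cong pow top-1≡k) (sumFrom-suc f m n) ⟩
      pow k -' (s +' fromℤ (+ d) *' pow k)             ≡⟨ cong (λ e → pow k -' (s +' fromℤ (+ e) *' pow k)) d≡0 ⟩
      pow k -' (s +' fromℤ (+ 0) *' pow k)             ≡⟨ cong (λ y → pow k -' (s +' y)) (*'-zeroˡ (pow k)) ⟩
      pow k -' (s +' 0θ)                               ≡⟨ cong (λ y → pow k -' y) (+'-identityʳ s) ⟩
      pow k -' s                                       ∎) (proj₁ ih)
      where
      open ≡-Reasoning
      d≡0 = trans (cong f (sym top-1≡k)) f[top-1]≡0

    below-next : Positive (pow (m + + suc n) -' sumFrom f m (suc n))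
    below-next with ℕ.m≤n⇒m<n∨m≡n (proj₁ greedy k)
    ... | inj₂ d≡a = positive-as (begin
      pow (m + + suc n) -' sumFrom f m (suc n)                   ≡⟨ cong₂ _-'_ pow-top (sumFrom-suc f m n) ⟩
      (fromℤ A *' pow k +' pow (k - + 1)) -' (s +' fromℤ (+ d) *' pow k) ≡⟨ cong (λ e → (fromℤ A *' pow k +' pow (k - + 1)) -' (s +' fromℤ (+ e) *' pow k)) d≡a ⟩
      (fromℤ A *' pow k +' pow (k - + 1)) -' (s +' fromℤ A *' pow k)     ≡⟨ cancel (fromℤ A) (pow k) (pow (k - + 1)) s ⟩
      pow (k - + 1) -' s                                         ∎) (proj₂ ih (proj₂ greedy k d≡a))
      where
      open ≡-Reasoning
      cancel : ∀ c p q s → (c *' p +' q) -' (s +' c *' p) ≡ q -' s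
      cancel = solve 4 (λ c p q s → (c ⊗ p ⊕ q) ⊕ ⊝ (s ⊕ c ⊗ p) ⊜ (q ⊕ ⊝ s)) refl
    ... | inj₁ d<a = positive-as (begin
      pow (m + + suc n) -' sumFrom f m (suc n)                              ≡⟨ cong₂ _-'_ pow-top (sumFrom-suc f m n) ⟩
      (fromℤ A *' pow k +' pow (k - + 1)) -' (s +' fromℤ (+ d) *' pow k)    ≡⟨ regroup (fromℤ A) (fromℤ (+ d)) (pow k) (pow (k - + 1)) s ⟩
      pow k *' fromℤ (A - + d - + 1) +' (pow k -' s) +' pow (k - + 1)       ∎)
      (Positive-+ (NonNegative-+-Positive (NonNegative-pow* k (NonNegative-fromℤ 0≤A-d-1)) (proj₁ ih)) (Positive-pow (k - + 1)))
      where
      open ≡-Reasoning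
      regroup : ∀ c e p q s → (c *' p +' q) -' (s +' e *' p) ≡ p *' (c -' e -' 1θ) +' (p -' s) +' q
      regroup = solve 5 (λ c e p q s → (c ⊗ p ⊕ q) ⊕ ⊝ (s ⊕ e ⊗ p) ⊜ (p ⊗ (c ⊕ ⊝ e ⊕ ⊝ Κ 1θ) ⊕ (p ⊕ ⊝ s) ⊕ q)) refl
      0≤A-d-1 : + 0 ℤ.≤ A - + d - + 1
      0≤A-d-1 = subst (+ 0 ℤ.≤_) (ℤ-regroup A (+ d)) (ℤ.i≤j⇒0≤j-i (+≤+ d<a))
        where
        ℤ-regroup : ∀ A d → A - (+ 1 + d) ≡ A - d - + 1
        ℤ-regroup = solve-∀

  sumFrom<pow : ∀ f → Greedy f → ∀ m n → Positive (pow (m + + n) -' sumFrom f m n)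
  sumFrom<pow f greedy m n = proj₁ (sumFrom-bounds f greedy m n)

  private
    top-digit-not-smaller : ∀ f g → Greedy f → ∀ m n → sumFrom f m (suc n) ≡ sumFrom g m (suc n) → ¬ f (m + + n) ℕ.< g (m + + n)
    top-digit-not-smaller f g greedy m n same f<g = Positive+NonNegative≢0
      (NonNegative-+-Positive (NonNegative-pow* k (NonNegative-fromℤ 0≤e-d-1)) (NonNegative-+-Positive (sumFrom-nonNegative g m n) (sumFrom<pow f greedy m n)))
      (inj₂ refl) (trans (+'-identityʳ _) (sym difference))
      where
      open ≡-Reasoning
      k : ℤ
      d e : ℕ
      k = m + + n
      d = f k
      e = g k
      0≤e-d-1 : + 0 ℤ.≤ + e - + d - + 1
      0≤e-d-1 = subst (+ 0 ℤ.≤_) (regroup (+ e) (+ d)) (ℤ.i≤j⇒0≤j-i (+≤+ f<g))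
        where
        regroup : ∀ e d → e - (+ 1 + d) ≡ e - d - + 1
        regroup = solve-∀
      X Y : Zθ
      X = sumFrom f m n +' fromℤ (+ d) *' pow k
      Y = sumFrom g m n +' fromℤ (+ e) *' pow k
      difference : 0θ ≡ pow k *' fromℤ (+ e - + d - + 1) +' (sumFrom g m n +' (pow k -' sumFrom f m n))
      difference = begin
        0θ       ≡⟨ -'-inverseʳ Y ⟨
        Y -' Y   ≡⟨ cong (λ y → Y -' y) (trans (sym (sumFrom-suc g m n)) (trans (sym same) (sumFrom-suc f m n))) ⟩
        Y -' X   ≡⟨ regroup (sumFrom f m n) (sumFrom g m n) (fromℤ (+ d)) (fromℤ (+ e)) (pow k) ⟩
        pow k *' fromℤ (+ e - + d - + 1) +' (sumFrom g m n +' (pow k -' sumFrom f m n)) ∎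
        where
        regroup : ∀ sf sg d e p → (sg +' e *' p) -' (sf +' d *' p) ≡ p *' (e -' d -' 1θ) +' (sg +' (p -' sf))
        regroup = solve 5 (λ sf sg d e p → (sg ⊕ e ⊗ p) ⊕ ⊝ (sf ⊕ d ⊗ p) ⊜ (p ⊗ (e ⊕ ⊝ d ⊕ ⊝ Κ 1θ) ⊕ (sg ⊕ (p ⊕ ⊝ sf)))) refl

  -- A larger top digit would outweigh all lower terms (sumFrom<pow).
  sumFrom-suc-injective : ∀ f g → Greedy f → Greedy g → ∀ m n → sumFrom f m (suc n) ≡ sumFrom g m (suc n) →
    f (m + + n) ≡ g (m + + n) × sumFrom f m n ≡ sumFrom g m n
  sumFrom-suc-injective f g greedy-f greedy-g m n same with ℕ.<-cmp (f (m + + n)) (g (m + + n))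
  ... | tri< f<g _ _ = ⊥-elim (top-digit-not-smaller f g greedy-f m n same f<g)
  ... | tri> _ _ g<f = ⊥-elim (top-digit-not-smaller g f greedy-g m n (sym same) g<f)
  ... | tri≈ _ f≡g _ = f≡g , cancel
    where
    k : ℤ
    c : Zθ
    k = m + + n
    c = fromℤ (+ g k) *' pow k
    same′ : sumFrom f m n +' c ≡ sumFrom g m n +' c
    same′ = trans (cong (λ e → sumFrom f m n +' fromℤ (+ e) *' pow k) (sym f≡g))
              (trans (sym (sumFrom-suc f m n)) (trans same (sumFrom-suc g m n)))
    cancel : sumFrom f m n ≡ sumFrom g m n
    cancel = begin
      sumFrom f m n            ≡⟨ +-cancel (sumFrom f m n) c ⟨
      sumFrom f m n +' c -' c  ≡⟨ cong (_-' c) same′ ⟩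
      sumFrom g m n +' c -' c  ≡⟨ +-cancel (sumFrom g m n) c ⟩
      sumFrom g m n            ∎
      where
      open ≡-Reasoning
      +-cancel : ∀ x c → x +' c -' c ≡ x
      +-cancel = solve 2 (λ x c → x ⊕ c ⊕ ⊝ c ⊜ x) refl

module LatticePoints (a : ℕ) (1≤a : 1 ℕ.≤ a) where
  open QuadraticIntegers a
  open Positivity a 1≤a

  κ : Zθ
  κ = θ +' 1/θ

  x-σx≡im*κ : ∀ x → x -' σ x ≡ fromℤ (im x) *' κ
  x-σx≡im*κ (mk p q) = cong₂ mk (re-eq A p q) (im-eq A q)
    where
    re-eq : ∀ A p q → p + - (p + q * A) ≡ q * (+ 0 + - A) + + 0 * (+ 1 + + 1)
    re-eq = solve-∀
    im-eq : ∀ A q → q + - (- q) ≡ q * (+ 1 + + 1) + + 0 * (+ 0 + - A) + + 0 * (+ 1 + + 1) * A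
    im-eq = solve-∀

  private
    Positive-κ : Positive κ
    Positive-κ = Positive-+ Positive-θ Positive-1/θ

    Positive-κ-1-1/θ² : Positive (κ -' 1θ -' 1/θ²)
    Positive-κ-1-1/θ² = positive-as (regroup θ 1/θ) (Positive-+ Positive-θ-1 Positive-1/θ-1/θ²)
      where
      regroup : ∀ t u → t +' u -' 1θ -' u *' u ≡ (t -' 1θ) +' (u -' u *' u)
      regroup = solve 2 (λ t u → t ⊕ u ⊕ ⊝ Κ 1θ ⊕ ⊝ (u ⊗ u) ⊜ ((t ⊕ ⊝ Κ 1θ) ⊕ (u ⊕ ⊝ (u ⊗ u)))) refl

    minus-im : ∀ c x → fromℤ (c - im x) *' κ ≡ fromℤ c *' κ -' (x -' σ x)
    minus-im c x = trans (expand (fromℤ c) (fromℤ (im x)) κ) (cong (λ y → fromℤ c *' κ -' y) (sym (x-σx≡im*κ x)))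
      where
      expand : ∀ c d k → (c -' d) *' k ≡ c *' k -' d *' k
      expand = solve 3 (λ c d k → (c ⊕ ⊝ d) ⊗ k ⊜ (c ⊗ k ⊕ ⊝ (d ⊗ k))) refl

    im-plus : ∀ c x → fromℤ (im x + c) *' κ ≡ (x -' σ x) +' fromℤ c *' κ
    im-plus c x = trans (*'-distribʳ-+' κ (fromℤ (im x)) (fromℤ c)) (cong (_+' fromℤ c *' κ) (sym (x-σx≡im*κ x)))

    -2<q<1⇒q≡0∨q≡-1 : ∀ q → + 0 ℤ.< + 1 - q → + 0 ℤ.< q + + 2 → q ≡ + 0 ⊎ q ≡ -[1+ 0 ]
    -2<q<1⇒q≡0∨q≡-1 (+ zero)          _        _        = inj₁ refl
    -2<q<1⇒q≡0∨q≡-1 (+ suc zero)      (+<+ ()) _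
    -2<q<1⇒q≡0∨q≡-1 (+ suc (suc n))   ()       _
    -2<q<1⇒q≡0∨q≡-1 -[1+ zero ]       _        _        = inj₂ refl
    -2<q<1⇒q≡0∨q≡-1 -[1+ suc zero ]   _        (+<+ ())
    -2<q<1⇒q≡0∨q≡-1 -[1+ suc (suc n) ] _       ()

    mk≡fromℤ-θ : ∀ p → mk p -[1+ 0 ] ≡ fromℤ (p - A) -' 1/θ
    mk≡fromℤ-θ p = cong₂ mk (re-eq A p) refl
      where
      re-eq : ∀ A p → p ≡ p - A + - - A
      re-eq = solve-∀

    integer-point : ∀ p → Positive (fromℤ (- p)) → Positive (fromℤ p +' 1θ +' 1/θ²) → p ≡ -[1+ 0 ]
    integer-point (+ zero)         -p>0 _ = ⊥-elim (¬Positive-0 -p>0)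
    integer-point (+ suc n)        -p>0 _ with () ← Positive-fromℤ⁻ -p>0
    integer-point -[1+ zero ]      _ _ = refl
    integer-point -[1+ suc n ]     _ p>-1-1/θ² = ⊥-elim (Positive+NonNegative≢0 p>-1-1/θ²
      (inj₁ (NonNegative-+-Positive (NonNegative-fromℤ {+ n} (+≤+ z≤n)) Positive-1-1/θ²)) (trans (regroup (fromℤ -[1+ suc n ]) (fromℤ (+ n)) 1/θ²) (cong fromℤ (cancel (+ n)))))
      where
      regroup : ∀ x y t → x +' 1θ +' t +' (y +' (1θ -' t)) ≡ x +' y +' 1θ +' 1θ
      regroup = solve 3 (λ x y t → x ⊕ Κ 1θ ⊕ t ⊕ (y ⊕ (Κ 1θ ⊕ ⊝ t)) ⊜ (x ⊕ y ⊕ Κ 1θ ⊕ Κ 1θ)) refl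
      cancel : ∀ n → - (+ 1 + (+ 1 + n)) + n + + 1 + + 1 ≡ + 0
      cancel = solve-∀

    -θ-point : ∀ p → Positive (-' mk p -[1+ 0 ]) → Positive (mk p -[1+ 0 ] +' 1θ +' 1/θ²) → p ≡ A
    -θ-point p r<0 r>-1-1/θ² with ℤ.<-cmp p A
    ... | tri≈ _ p≡A _ = p≡A
    ... | tri< p<A _ _ = ⊥-elim (Positive+NonNegative≢0 r>-1-1/θ²
      (inj₁ (NonNegative-+-Positive (NonNegative-fromℤ (0≤A-1-p p<A)) Positive-1/θ-1/θ²))
      (trans (cong (λ r → r +' 1θ +' 1/θ² +' (fromℤ (A - + 1 - p) +' (1/θ -' 1/θ²))) (mk≡fromℤ-θ p)) (regroup (fromℤ p) (fromℤ A) 1/θ 1/θ²)))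
      where
      0≤A-1-p : p ℤ.< A → + 0 ℤ.≤ A - + 1 - p
      0≤A-1-p p<A = subst (+ 0 ℤ.≤_) (eq A p) (ℤ.i≤j⇒0≤j-i (ℤ.i<j⇒suc[i]≤j p<A))
        where
        eq : ∀ A p → A - (+ 1 + p) ≡ A - + 1 - p
        eq = solve-∀
      regroup : ∀ x y u t → (x -' y) -' u +' 1θ +' t +' ((y -' 1θ -' x) +' (u -' t)) ≡ 0θ
      regroup = solve 4 (λ x y u t → (x ⊕ ⊝ y) ⊕ ⊝ u ⊕ Κ 1θ ⊕ t ⊕ ((y ⊕ ⊝ Κ 1θ ⊕ ⊝ x) ⊕ (u ⊕ ⊝ t)) ⊜ Κ 0θ) refl
    ... | tri> _ _ p>A = ⊥-elim (Positive+NonNegative≢0 r<0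
      (inj₁ (NonNegative-+-Positive (NonNegative-fromℤ (0≤p-A-1 p>A)) Positive-1-1/θ))
      (trans (cong (λ r → -' r +' (fromℤ (p - A - + 1) +' (1θ -' 1/θ))) (mk≡fromℤ-θ p)) (regroup (fromℤ p) (fromℤ A) 1/θ)))
      where
      0≤p-A-1 : A ℤ.< p → + 0 ℤ.≤ p - A - + 1
      0≤p-A-1 A<p = subst (+ 0 ℤ.≤_) (eq A p) (ℤ.i≤j⇒0≤j-i (ℤ.i<j⇒suc[i]≤j A<p))
        where
        eq : ∀ A p → p - (+ 1 + A) ≡ p - A - + 1
        eq = solve-∀
      regroup : ∀ x y u → -' ((x -' y) -' u) +' ((x -' y -' 1θ) +' (1θ -' u)) ≡ 0θ
      regroup = solve 3 (λ x y u → ⊝ ((x ⊕ ⊝ y) ⊕ ⊝ u) ⊕ ((x ⊕ ⊝ y ⊕ ⊝ Κ 1θ) ⊕ (Κ 1θ ⊕ ⊝ u)) ⊜ Κ 0θ) refl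

    negative-point-im : ∀ r → Positive (-' r) → Positive (r +' 1θ +' 1/θ²) →
      Positive (θ +' 1/θ² -' σ r) → Positive (σ r +' 1θ +' 1/θ²) → im r ≡ + 0 ⊎ im r ≡ -[1+ 0 ]
    negative-point-im r r<0 r>-1-1/θ² σr<θ+1/θ² σr>-1-1/θ² = -2<q<1⇒q≡0∨q≡-1 (im r) q<1 q>-2
      where
      q<1 : + 0 ℤ.< + 1 - im r
      q<1 = Positive-fromℤ*⁻ (positive-as (trans (minus-im (+ 1) r) (regroup θ 1/θ r (σ r)))
              (Positive-+ (Positive-+ r<0 σr>-1-1/θ²) Positive-κ-1-1/θ²)) Positive-κ
        where
        regroup : ∀ t v r s → 1θ *' (t +' v) -' (r -' s) ≡ -' r +' (s +' 1θ +' v *' v) +' (t +' v -' 1θ -' v *' v)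
        regroup = solve 4 (λ t v r s → Κ 1θ ⊗ (t ⊕ v) ⊕ ⊝ (r ⊕ ⊝ s) ⊜ (⊝ r ⊕ (s ⊕ Κ 1θ ⊕ v ⊗ v) ⊕ (t ⊕ v ⊕ ⊝ Κ 1θ ⊕ ⊝ (v ⊗ v)))) refl
      q>-2 : + 0 ℤ.< im r + + 2
      q>-2 = Positive-fromℤ*⁻ (positive-as (trans (im-plus (+ 2) r) (regroup θ 1/θ r (σ r)))
               (Positive-+ (Positive-+ r>-1-1/θ² σr<θ+1/θ²) (Positive-+ Positive-κ-1-1/θ² Positive-1/θ-1/θ²))) Positive-κ
        where
        regroup : ∀ t v r s → (r -' s) +' (1θ +' 1θ) *' (t +' v)
                            ≡ (r +' 1θ +' v *' v) +' (t +' v *' v -' s) +' ((t +' v -' 1θ -' v *' v) +' (v -' v *' v))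
        regroup = solve 4 (λ t v r s → (r ⊕ ⊝ s) ⊕ (Κ 1θ ⊕ Κ 1θ) ⊗ (t ⊕ v)
                            ⊜ ((r ⊕ Κ 1θ ⊕ v ⊗ v) ⊕ (t ⊕ v ⊗ v ⊕ ⊝ s) ⊕ ((t ⊕ v ⊕ ⊝ Κ 1θ ⊕ ⊝ (v ⊗ v)) ⊕ (v ⊕ ⊝ (v ⊗ v))))) refl

    negative-point-cases : ∀ p q → q ≡ + 0 ⊎ q ≡ -[1+ 0 ] → Positive (-' mk p q) → Positive (mk p q +' 1θ +' 1/θ²) →
      mk p q ≡ -' 1θ ⊎ mk p q ≡ -' 1/θ
    negative-point-cases p _ (inj₁ refl) r<0 r>-1-1/θ² = inj₁ (cong₂ mk (integer-point p r<0 r>-1-1/θ²) refl)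
    negative-point-cases p _ (inj₂ refl) r<0 r>-1-1/θ² = inj₂ (cong₂ mk (trans (-θ-point p r<0 r>-1-1/θ²) (sym (ℤ.neg-involutive A))) refl)

  negative-lattice-points : ∀ r → Positive (-' r) → Positive (r +' 1θ +' 1/θ²) →
    Positive (θ +' 1/θ² -' σ r) → Positive (σ r +' 1θ +' 1/θ²) → r ≡ -' 1θ ⊎ r ≡ -' 1/θ
  negative-lattice-points r@(mk p q) r<0 r>-1-1/θ² σr<θ+1/θ² σr>-1-1/θ² =
    negative-point-cases p q (negative-point-im r r<0 r>-1-1/θ² σr<θ+1/θ² σr>-1-1/θ²) r<0 r>-1-1/θ²

  private
    -1<q<2⇒q≡0∨q≡1 : ∀ q → + 0 ℤ.< q + + 1 → + 0 ℤ.< + 2 - q → q ≡ + 0 ⊎ q ≡ + 1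
    -1<q<2⇒q≡0∨q≡1 (+ zero)               _        _        = inj₁ refl
    -1<q<2⇒q≡0∨q≡1 (+ suc zero)           _        _        = inj₂ refl
    -1<q<2⇒q≡0∨q≡1 (+ suc (suc zero))     _        (+<+ ())
    -1<q<2⇒q≡0∨q≡1 (+ suc (suc (suc n)))  _        ()
    -1<q<2⇒q≡0∨q≡1 -[1+ zero ]            (+<+ ()) _
    -1<q<2⇒q≡0∨q≡1 -[1+ suc n ]           ()       _

    unit-point-im : ∀ z → NonNegative z → Positive (1θ -' z) →
      Positive (σ z +' θ +' 1/θ²) → Positive (1θ +' 1/θ² -' σ z) → im z ≡ + 0 ⊎ im z ≡ + 1
    unit-point-im z z≥0 z<1 σz>-θ-1/θ² σz<1+1/θ² = -1<q<2⇒q≡0∨q≡1 (im z) q>-1 q<2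
      where
      q>-1 : + 0 ℤ.< im z + + 1
      q>-1 = Positive-fromℤ*⁻ (positive-as (trans (im-plus (+ 1) z) (regroup θ 1/θ z (σ z)))
               (NonNegative-+-Positive z≥0 (Positive-+ σz<1+1/θ² Positive-κ-1-1/θ²))) Positive-κ
        where
        regroup : ∀ t v z s → (z -' s) +' 1θ *' (t +' v) ≡ z +' ((1θ +' v *' v -' s) +' (t +' v -' 1θ -' v *' v))
        regroup = solve 4 (λ t v z s → (z ⊕ ⊝ s) ⊕ Κ 1θ ⊗ (t ⊕ v) ⊜ (z ⊕ ((Κ 1θ ⊕ v ⊗ v ⊕ ⊝ s) ⊕ (t ⊕ v ⊕ ⊝ Κ 1θ ⊕ ⊝ (v ⊗ v))))) refl
      q<2 : + 0 ℤ.< + 2 - im z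
      q<2 = Positive-fromℤ*⁻ (positive-as (trans (minus-im (+ 2) z) (regroup θ 1/θ z (σ z)))
              (Positive-+ (Positive-+ z<1 σz>-θ-1/θ²) (Positive-+ Positive-κ-1-1/θ² Positive-1/θ))) Positive-κ
        where
        regroup : ∀ t v z s → (1θ +' 1θ) *' (t +' v) -' (z -' s)
                            ≡ (1θ -' z) +' (s +' t +' v *' v) +' ((t +' v -' 1θ -' v *' v) +' v)
        regroup = solve 4 (λ t v z s → (Κ 1θ ⊕ Κ 1θ) ⊗ (t ⊕ v) ⊕ ⊝ (z ⊕ ⊝ s)
                            ⊜ ((Κ 1θ ⊕ ⊝ z) ⊕ (s ⊕ t ⊕ v ⊗ v) ⊕ ((t ⊕ v ⊕ ⊝ Κ 1θ ⊕ ⊝ (v ⊗ v)) ⊕ v))) refl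

    integer-unit-point : ∀ p → NonNegative (fromℤ p) → Positive (fromℤ (+ 1 - p)) → p ≡ + 0
    integer-unit-point (+ zero)           _ _   = refl
    integer-unit-point (+ suc zero)       _ 1-p>0 = ⊥-elim (¬Positive-0 1-p>0)
    integer-unit-point (+ suc (suc n))    _ 1-p>0 with () ← Positive-fromℤ⁻ 1-p>0
    integer-unit-point -[1+ n ] (inj₁ p>0) _ with () ← Positive-fromℤ⁻ p>0

    mk≡fromℤ+θ : ∀ p → mk p (+ 1) ≡ fromℤ (p + A) +' 1/θ
    mk≡fromℤ+θ p = cong₂ mk (re-eq A p) refl
      where
      re-eq : ∀ A p → p ≡ p + A + - A
      re-eq = solve-∀

    1/θ-point : ∀ p → Positive (mk p (+ 1)) → Positive (1θ -' mk p (+ 1)) → p ≡ - A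
    1/θ-point p z>0 z<1 with ℤ.<-cmp p (- A)
    ... | tri≈ _ p≡-A _ = p≡-A
    ... | tri< p<-A _ _ = ⊥-elim (Positive+NonNegative≢0 z>0
      (inj₁ (NonNegative-+-Positive (NonNegative-fromℤ 0≤-A-1-p) Positive-1-1/θ))
      (trans (cong (λ z → z +' (fromℤ (- A - + 1 - p) +' (1θ -' 1/θ))) (mk≡fromℤ+θ p)) (regroup (fromℤ p) (fromℤ A) 1/θ)))
      where
      0≤-A-1-p : + 0 ℤ.≤ - A - + 1 - p
      0≤-A-1-p = subst (+ 0 ℤ.≤_) (eq A p) (ℤ.i≤j⇒0≤j-i (ℤ.i<j⇒suc[i]≤j p<-A))
        where
        eq : ∀ A p → - A - (+ 1 + p) ≡ - A - + 1 - p
        eq = solve-∀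
      regroup : ∀ x y u → (x +' y) +' u +' ((-' y -' 1θ -' x) +' (1θ -' u)) ≡ 0θ
      regroup = solve 3 (λ x y u → (x ⊕ y) ⊕ u ⊕ ((⊝ y ⊕ ⊝ Κ 1θ ⊕ ⊝ x) ⊕ (Κ 1θ ⊕ ⊝ u)) ⊜ Κ 0θ) refl
    ... | tri> _ _ p>-A = ⊥-elim (Positive+NonNegative≢0 z<1
      (inj₁ (NonNegative-+-Positive (NonNegative-fromℤ 0≤p+A-1) Positive-1/θ))
      (trans (cong (λ z → 1θ -' z +' (fromℤ (p + A - + 1) +' 1/θ)) (mk≡fromℤ+θ p)) (regroup (fromℤ p) (fromℤ A) 1/θ)))
      where
      0≤p+A-1 : + 0 ℤ.≤ p + A - + 1
      0≤p+A-1 = subst (+ 0 ℤ.≤_) (eq A p) (ℤ.i≤j⇒0≤j-i (ℤ.i<j⇒suc[i]≤j p>-A))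
        where
        eq : ∀ A p → p - (+ 1 + - A) ≡ p + A - + 1
        eq = solve-∀
      regroup : ∀ x y u → 1θ -' ((x +' y) +' u) +' ((x +' y -' 1θ) +' u) ≡ 0θ
      regroup = solve 3 (λ x y u → Κ 1θ ⊕ ⊝ ((x ⊕ y) ⊕ u) ⊕ ((x ⊕ y ⊕ ⊝ Κ 1θ) ⊕ u) ⊜ Κ 0θ) refl

    unit-point-cases : ∀ p q → q ≡ + 0 ⊎ q ≡ + 1 → NonNegative (mk p q) → Positive (1θ -' mk p q) →
      mk p q ≡ 0θ ⊎ mk p q ≡ 1/θ
    unit-point-cases p _ (inj₁ refl) z≥0 z<1 = inj₁ (cong₂ mk (integer-unit-point p z≥0 z<1) refl)
    unit-point-cases p _ (inj₂ refl) (inj₁ z>0) z<1 = inj₂ (cong₂ mk (1/θ-point p z>0 z<1) refl)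

  unit-interval-lattice-points : ∀ z → NonNegative z → Positive (1θ -' z) →
    Positive (σ z +' θ +' 1/θ²) → Positive (1θ +' 1/θ² -' σ z) → z ≡ 0θ ⊎ z ≡ 1/θ
  unit-interval-lattice-points z@(mk p q) z≥0 z<1 σz>-θ-1/θ² σz<1+1/θ² =
    unit-point-cases p q (unit-point-im z z≥0 z<1 σz>-θ-1/θ² σz<1+1/θ²) z≥0 z<1

module ConjugateDecay (a : ℕ) (1≤a : 1 ℕ.≤ a) where
  open QuadraticIntegers a
  open Positivity a 1≤a
  open GreedySums a 1≤a using (InWindow)

  infix 4 ∣_∣<_
  record ∣_∣<_ (x B : Zθ) : Set where
    constructor bounded
    field
      upper : Positive (B -' x)
      lower : Positive (x +' B)

  ∣-∣<-neg : ∀ {x B} → ∣ x ∣< B → ∣ -' x ∣< B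
  ∣-∣<-neg {x} {B} (bounded x<B -B<x) = bounded (positive-as (upper-eq B x) -B<x) (positive-as (lower-eq B x) x<B)
    where
    upper-eq : ∀ b x → b -' -' x ≡ x +' b
    upper-eq = solve 2 (λ b x → b ⊕ ⊝ (⊝ x) ⊜ (x ⊕ b)) refl
    lower-eq : ∀ b x → -' x +' b ≡ b -' x
    lower-eq = solve 2 (λ b x → ⊝ x ⊕ b ⊜ (b ⊕ ⊝ x)) refl

  ∣-∣<-mono : ∀ {x B B′} → ∣ x ∣< B → NonNegative (B′ -' B) → ∣ x ∣< B′
  ∣-∣<-mono {x} {B} {B′} (bounded x<B -B<x) B≤B′ = bounded
    (positive-as (upper-eq B B′ x) (NonNegative-+-Positive B≤B′ x<B))
    (positive-as (lower-eq B B′ x) (NonNegative-+-Positive B≤B′ -B<x))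
    where
    upper-eq : ∀ b b′ x → b′ -' x ≡ (b′ -' b) +' (b -' x)
    upper-eq = solve 3 (λ b b′ x → b′ ⊕ ⊝ x ⊜ ((b′ ⊕ ⊝ b) ⊕ (b ⊕ ⊝ x))) refl
    lower-eq : ∀ b b′ x → x +' b′ ≡ (b′ -' b) +' (x +' b)
    lower-eq = solve 3 (λ b b′ x → x ⊕ b′ ⊜ ((b′ ⊕ ⊝ b) ⊕ (x ⊕ b))) refl

  ∣-∣<-σ-θ* : ∀ {x B} → ∣ σ x ∣< B → ∣ σ (θ *' x) ∣< 1/θ *' B
  ∣-∣<-σ-θ* {x} {B} (bounded σx<B -B<σx) = bounded
    (positive-as (trans (cong (λ y → 1/θ *' B -' y) σθx) (upper-eq 1/θ B (σ x))) (Positive-1/θ* -B<σx))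
    (positive-as (trans (cong (_+' 1/θ *' B) σθx) (lower-eq 1/θ B (σ x))) (Positive-1/θ* σx<B))
    where
    upper-eq : ∀ u b y → u *' b -' (-' u) *' y ≡ u *' (y +' b)
    upper-eq = solve 3 (λ u b y → u ⊗ b ⊕ ⊝ ((⊝ u) ⊗ y) ⊜ u ⊗ (y ⊕ b)) refl
    lower-eq : ∀ u b y → (-' u) *' y +' u *' b ≡ u *' (b -' y)
    lower-eq = solve 3 (λ u b y → (⊝ u) ⊗ y ⊕ u ⊗ b ⊜ u ⊗ (b ⊕ ⊝ y)) refl
    σθx : σ (θ *' x) ≡ -' 1/θ *' σ x
    σθx = trans (σ-* θ x) (cong (_*' σ x) σ-θ)

  ∣-∣<-σ-pow* : ∀ u {x B} → ∣ σ x ∣< B → ∣ σ (pow (+ u) *' x) ∣< powθ a 1/θ u *' B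
  ∣-∣<-σ-pow* zero    {x} {B} h = subst₂ ∣_∣<_ (cong σ (sym (*'-identityˡ x))) (sym (*'-identityˡ B)) h
  ∣-∣<-σ-pow* (suc u) {x} {B} h = subst₂ ∣_∣<_ (cong σ (sym θ^[1+u]x)) (sym 1/θ^[1+u]B) (∣-∣<-σ-θ* {pow (+ u) *' x} (∣-∣<-σ-pow* u {x} h))
    where
    θ^[1+u]x : pow (+ suc u) *' x ≡ θ *' (pow (+ u) *' x)
    θ^[1+u]x = pow-suc*x u x
    1/θ^[1+u]B : powθ a 1/θ (suc u) *' B ≡ 1/θ *' (powθ a 1/θ u *' B)
    1/θ^[1+u]B = trans (cong (_*' B) (mulθ≡*' 1/θ (powθ a 1/θ u))) (*'-assoc 1/θ _ B)

  1/θ^≤1 : ∀ u → NonNegative (1θ -' powθ a 1/θ u)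
  1/θ^≤1 zero    = inj₂ (-'-inverseʳ 1θ)
  1/θ^≤1 (suc u) = inj₁ (positive-as (trans (cong (λ y → 1θ -' y) (mulθ≡*' 1/θ (powθ a 1/θ u))) (regroup 1/θ (powθ a 1/θ u)))
                          (NonNegative-+-Positive (NonNegative-1/θ* (1/θ^≤1 u)) Positive-1-1/θ))
    where
    regroup : ∀ v p → 1θ -' v *' p ≡ v *' (1θ -' p) +' (1θ -' v)
    regroup = solve 2 (λ v p → Κ 1θ ⊕ ⊝ (v ⊗ p) ⊜ (v ⊗ (Κ 1θ ⊕ ⊝ p) ⊕ (Κ 1θ ⊕ ⊝ v))) refl

  InWindow⇒∣-∣<θ : ∀ {w} → InWindow w → ∣ w ∣< pow (+ 1)
  InWindow⇒∣-∣<θ {w} (-1<w , w<θ) = subst (∣ w ∣<_) (sym pow-1) (bounded w<θ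
    (positive-as (regroup w θ) (Positive-+ -1<w Positive-θ-1)))
    where
    regroup : ∀ w t → w +' t ≡ (w +' 1θ) +' (t -' 1θ)
    regroup = solve 2 (λ w t → w ⊕ t ⊜ ((w ⊕ Κ 1θ) ⊕ (t ⊕ ⊝ Κ 1θ))) refl
    pow-1 : pow (+ 1) ≡ θ
    pow-1 = trans (mulθ≡*' θ 1θ) (*'-identityʳ θ)

  -- σ(θⁿY) = (-1/θ)ⁿσY, and n exceeds c by at least 2.
  ∣σ-pow*∣<1/θ² : ∀ c v {Y} → ∣ σ Y ∣< pow (+ c) → ∣ σ (pow (+ (c ℕ.+ (2 ℕ.+ v))) *' Y) ∣< 1/θ²
  ∣σ-pow*∣<1/θ² c v {Y} |σY|<θ^c = ∣-∣<-mono (∣-∣<-σ-pow* n |σY|<θ^c) (subst NonNegative (sym bound) (NonNegative-1/θ* (NonNegative-1/θ* (1/θ^≤1 v))))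
    where
    open ≡-Reasoning
    n : ℕ
    n = c ℕ.+ (2 ℕ.+ v)
    powθ-1/θ : ∀ n → powθ a 1/θ n ≡ pow (- + n)
    powθ-1/θ zero    = refl
    powθ-1/θ (suc n) = refl
    exponent : - + n + + c ≡ - + (2 ℕ.+ v)
    exponent = eq (+ c) (+ v)
      where
      eq : ∀ c v → - (c + (+ 1 + (+ 1 + v))) + c ≡ - (+ 1 + (+ 1 + v))
      eq = solve-∀
    P : Zθ
    P = powθ a 1/θ v
    bound : 1/θ² -' powθ a 1/θ n *' pow (+ c) ≡ 1/θ *' (1/θ *' (1θ -' P))
    bound = begin
      1/θ² -' powθ a 1/θ n *' pow (+ c)     ≡⟨ cong (λ y → 1/θ² -' y *' pow (+ c)) (powθ-1/θ n) ⟩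
      1/θ² -' pow (- + n) *' pow (+ c)      ≡⟨ cong (λ y → 1/θ² -' y) (trans (sym (pow-+ (- + n) (+ c))) (cong pow exponent)) ⟩
      1/θ² -' pow (- + (2 ℕ.+ v))           ≡⟨ cong (λ y → 1/θ² -' y) (trans (mulθ≡*' 1/θ _) (cong (1/θ *'_) (mulθ≡*' 1/θ P))) ⟩
      1/θ² -' 1/θ *' (1/θ *' P)             ≡⟨ factor 1/θ P ⟩
      1/θ *' (1/θ *' (1θ -' P))             ∎
      where
      factor : ∀ u p → u *' u -' u *' (u *' p) ≡ u *' (u *' (1θ -' p))
      factor = solve 2 (λ u p → u ⊗ u ⊕ ⊝ (u ⊗ (u ⊗ p)) ⊜ u ⊗ (u ⊗ (Κ 1θ ⊕ ⊝ p))) refl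

module Existence (a : ℕ) (1≤a : 1 ℕ.≤ a) where
  open QuadraticIntegers a
  open Positivity a 1≤a
  open GreedySums a 1≤a
  open LatticePoints a 1≤a
  open ConjugateDecay a 1≤a

  record IsLargestDigit (b : ℕ) (R : Zθ) (k : ℤ) (d : ℕ) : Set where
    field
      d≤b     : d ℕ.≤ b
      rest≥0  : NonNegative (R -' fromℤ (+ d) *' pow k)
      maximal : d ℕ.< b → Positive (fromℤ (+ suc d) *' pow k -' R)

  largestDigit : ℕ → Zθ → ℤ → ℕ
  largestDigit zero    R k = 0
  largestDigit (suc b) R k with nonNegative⊎negative (R -' fromℤ (+ suc b) *' pow k)
  ... | inj₁ _ = suc b
  ... | inj₂ _ = largestDigit b R k

  largestDigit-spec : ∀ b R k → NonNegative R → IsLargestDigit b R k (largestDigit b R k)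
  largestDigit-spec zero R k R≥0 = record
    { d≤b = z≤n ; rest≥0 = subst NonNegative (sym (R-0 R (pow k))) R≥0 ; maximal = λ () }
    where
    R-0 : ∀ r p → r -' fromℤ (+ 0) *' p ≡ r
    R-0 = solve 2 (λ r p → r ⊕ ⊝ (Κ (fromℤ (+ 0)) ⊗ p) ⊜ r) refl
  largestDigit-spec (suc b) R k R≥0 with nonNegative⊎negative (R -' fromℤ (+ suc b) *' pow k)
  ... | inj₁ rest≥0 = record { d≤b = ℕ.≤-refl ; rest≥0 = rest≥0 ; maximal = λ b<b → ⊥-elim (ℕ.<-irrefl refl b<b) }
  ... | inj₂ rest<0 = record { d≤b = ℕ.m≤n⇒m≤1+n d≤b ; rest≥0 = rest≥0 ; maximal = maximal′ }
    where
    open IsLargestDigit (largestDigit-spec b R k R≥0)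
    d : ℕ
    d = largestDigit b R k
    maximal′ : d ℕ.< suc b → Positive (fromℤ (+ suc d) *' pow k -' R)
    maximal′ d<1+b with ℕ.m≤n⇒m<n∨m≡n (ℕ.≤-pred d<1+b)
    ... | inj₁ d<b = maximal d<b
    ... | inj₂ d≡b = subst (λ e → Positive (fromℤ (+ suc e) *' pow k -' R)) (sym d≡b)
                       (positive-as (flip R (fromℤ (+ suc b) *' pow k)) rest<0)
      where
      flip : ∀ r x → x -' r ≡ -' (r -' x)
      flip = solve 2 (λ r x → x ⊕ ⊝ r ⊜ ⊝ (r ⊕ ⊝ x)) refl

  greedyDigit : Zθ → ℤ → ℕ
  greedyDigit = largestDigit a

  greedyRest : Zθ → ℤ → Zθ
  greedyRest R k = R -' fromℤ (+ greedyDigit R k) *' pow k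

  greedyRest-bounds : ∀ R k → NonNegative R → Positive (pow (k + + 1) -' R) →
    NonNegative (greedyRest R k) × Positive (pow k -' greedyRest R k) ×
    (greedyDigit R k ≡ a → Positive (pow (k - + 1) -' greedyRest R k))
  greedyRest-bounds R k R≥0 R<θ^[k+1] = rest≥0 , rest<θ^k , rest<θ^[k-1]
    where
    open IsLargestDigit (largestDigit-spec a R k R≥0)
    d : ℕ
    d = greedyDigit R k
    rest<θ^[k-1] : d ≡ a → Positive (pow (k - + 1) -' greedyRest R k)
    rest<θ^[k-1] d≡a = positive-as (begin
      pow (k - + 1) -' (R -' fromℤ (+ d) *' pow k)      ≡⟨ cong (λ e → pow (k - + 1) -' (R -' fromℤ (+ e) *' pow k)) d≡a ⟩
      pow (k - + 1) -' (R -' fromℤ A *' pow k)          ≡⟨ regroup (fromℤ A) (pow k) (pow (k - + 1)) R ⟩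
      (fromℤ A *' pow k +' pow (k - + 1)) -' R          ≡⟨ cong (_-' R) (pow-recurrence k) ⟨
      pow (k + + 1) -' R                                ∎) R<θ^[k+1]
      where
      open ≡-Reasoning
      regroup : ∀ c p q r → q -' (r -' c *' p) ≡ (c *' p +' q) -' r
      regroup = solve 4 (λ c p q r → q ⊕ ⊝ (r ⊕ ⊝ (c ⊗ p)) ⊜ ((c ⊗ p ⊕ q) ⊕ ⊝ r)) refl
    rest<θ^k : Positive (pow k -' greedyRest R k)
    rest<θ^k = [ below-a , equal-a ]′ (ℕ.m≤n⇒m<n∨m≡n d≤b)
      where
      below-a : d ℕ.< a → Positive (pow k -' greedyRest R k)
      below-a d<a = positive-as (regroup (pow k) R (fromℤ (+ d))) (maximal d<a)
        where
        regroup : ∀ p r c → p -' (r -' c *' p) ≡ (1θ +' c) *' p -' r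
        regroup = solve 3 (λ p r c → p ⊕ ⊝ (r ⊕ ⊝ (c ⊗ p)) ⊜ ((Κ 1θ ⊕ c) ⊗ p ⊕ ⊝ r)) refl
      equal-a : d ≡ a → Positive (pow k -' greedyRest R k)
      equal-a d≡a = positive-as (split (pow k) (pow (k - + 1)) (greedyRest R k))
                      (NonNegative-+-Positive (subst (λ i → NonNegative (pow i -' pow (k - + 1))) (k-1+1≡k k) (pow-mono (k - + 1) 1)) (rest<θ^[k-1] d≡a))
        where
        k-1+1≡k : ∀ k → k - + 1 + + 1 ≡ k
        k-1+1≡k = solve-∀
        split : ∀ p q y → p -' y ≡ (p -' q) +' (q -' y)
        split = solve 3 (λ p q y → p ⊕ ⊝ y ⊜ ((p ⊕ ⊝ q) ⊕ (q ⊕ ⊝ y))) refl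

  greedyDigit≡0 : ∀ R k → NonNegative R → Positive (pow k -' R) → greedyDigit R k ≡ 0
  greedyDigit≡0 R k R≥0 R<θ^k with greedyDigit R k | largestDigit-spec a R k R≥0
  ... | zero  | _    = refl
  ... | suc r | spec = ⊥-elim (1-[1+r]≯0 r (Positive-fromℤ*⁻ (positive-as (sym (telescope R (fromℤ (+ suc r)) (pow k)))
                         (NonNegative-+-Positive (IsLargestDigit.rest≥0 spec) R<θ^k)) (Positive-pow k)))
    where
    1-[1+r]≯0 : ∀ r → ¬ (+ 0 ℤ.< + 1 - + suc r)
    1-[1+r]≯0 zero    (+<+ ())
    1-[1+r]≯0 (suc r) ()
    telescope : ∀ r c p → (r -' c *' p) +' (p -' r) ≡ (1θ -' c) *' p
    telescope = solve 3 (λ r c p → (r ⊕ ⊝ (c ⊗ p)) ⊕ (p ⊕ ⊝ r) ⊜ (Κ 1θ ⊕ ⊝ c) ⊗ p) refl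

  greedyDigit-pow : ∀ k → greedyDigit (pow k) k ≡ 1
  greedyDigit-pow k with greedyDigit (pow k) k | largestDigit-spec a (pow k) k (inj₁ (Positive-pow k))
  ... | zero          | spec = ⊥-elim (¬Positive-0 (positive-as (sym (trans (cong (_-' pow k) (*'-identityˡ (pow k))) (-'-inverseʳ (pow k))))
                                 (IsLargestDigit.maximal spec 1≤a)))
  ... | suc zero      | _    = refl
  ... | suc (suc r)   | spec = ⊥-elim (Positive⇒¬NonNegative-neg (Positive-fromℤ* {+ suc r} (+<+ (s≤s z≤n)) (Positive-pow k))
                                 (subst NonNegative (negate (pow k) (fromℤ (+ suc r))) (IsLargestDigit.rest≥0 spec)))
    where
    negate : ∀ p c → p -' (1θ +' c) *' p ≡ -' (c *' p)
    negate = solve 2 (λ p c → p ⊕ ⊝ ((Κ 1θ ⊕ c) ⊗ p) ⊜ ⊝ (c ⊗ p)) refl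

  a≢0 : a ≢ 0
  a≢0 a≡0 = ℕ.<-irrefl refl (subst (0 ℕ.<_) a≡0 1≤a)

  alternating : ℕ → ℕ
  alternating zero          = 0
  alternating (suc zero)    = a
  alternating (suc (suc u)) = alternating u

  alternating-step : ∀ u → (alternating u ≡ 0 × alternating (suc u) ≡ a) ⊎ (alternating u ≡ a × alternating (suc u) ≡ 0)
  alternating-step zero          = inj₁ (refl , refl)
  alternating-step (suc zero)    = inj₂ (refl , refl)
  alternating-step (suc (suc u)) = alternating-step u

  -- 0 + aθ^(J+1) + 0 + aθ^(J+3) + ⋯ telescopes by aθ^k = θ^(k+1) - θ^(k-1).
  alternating-sumFrom : ∀ f J → (∀ u → f (J + + u) ≡ alternating u) → ∀ w →
    (sumFrom f J w ≡ pow (J + + w) -' pow J × alternating w ≡ 0) ⊎ (sumFrom f J w ≡ pow (J + + w - + 1) -' pow J × alternating w ≡ a)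
  alternating-sumFrom f J tail zero    = inj₁ (sym (trans (cong (λ i → pow i -' pow J) (ℤ.+-identityʳ J)) (-'-inverseʳ (pow J))) , refl)
  alternating-sumFrom f J tail (suc w) with alternating-sumFrom f J tail w | alternating-step w
  ... | inj₁ (S≡ , _) | inj₁ (alt≡0 , alt′≡a) = inj₂ ((begin
    sumFrom f J (suc w)                                        ≡⟨ sumFrom-suc f J w ⟩
    sumFrom f J w +' fromℤ (+ f (J + + w)) *' pow (J + + w)    ≡⟨ cong₂ (λ s d → s +' fromℤ (+ d) *' pow (J + + w)) S≡ (trans (tail w) alt≡0) ⟩
    (pow (J + + w) -' pow J) +' fromℤ (+ 0) *' pow (J + + w)   ≡⟨ add-0 (pow (J + + w)) (pow J) ⟩
    pow (J + + w) -' pow J                                     ≡⟨ cong (λ i → pow i -' pow J) (shift J (+ w)) ⟩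
    pow (J + + suc w - + 1) -' pow J                           ∎) , alt′≡a)
    where
    open ≡-Reasoning
    shift : ∀ J w → J + w ≡ J + (+ 1 + w) - + 1
    shift = solve-∀
    add-0 : ∀ p q → (p -' q) +' fromℤ (+ 0) *' p ≡ p -' q
    add-0 = solve 2 (λ p q → (p ⊕ ⊝ q) ⊕ Κ (fromℤ (+ 0)) ⊗ p ⊜ (p ⊕ ⊝ q)) refl
  ... | inj₂ (S≡ , _) | inj₂ (alt≡a , alt′≡0) = inj₁ ((begin
    sumFrom f J (suc w)                                              ≡⟨ sumFrom-suc f J w ⟩
    sumFrom f J w +' fromℤ (+ f (J + + w)) *' pow (J + + w)          ≡⟨ cong₂ (λ s d → s +' fromℤ (+ d) *' pow (J + + w)) S≡ (trans (tail w) alt≡a) ⟩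
    (pow (J + + w - + 1) -' pow J) +' fromℤ A *' pow (J + + w)       ≡⟨ regroup (pow (J + + w - + 1)) (pow J) (fromℤ A) (pow (J + + w)) ⟩
    (fromℤ A *' pow (J + + w) +' pow (J + + w - + 1)) -' pow J       ≡⟨ cong (_-' pow J) (pow-recurrence (J + + w)) ⟨
    pow (J + + w + + 1) -' pow J                                     ≡⟨ cong (λ i → pow i -' pow J) (shift J (+ w)) ⟩
    pow (J + + suc w) -' pow J                                       ∎) , alt′≡0)
    where
    open ≡-Reasoning
    shift : ∀ J w → J + w + + 1 ≡ J + (+ 1 + w)
    shift = solve-∀
    regroup : ∀ q j c p → (q -' j) +' c *' p ≡ (c *' p +' q) -' j
    regroup = solve 4 (λ q j c p → (q ⊕ ⊝ j) ⊕ c ⊗ p ⊜ ((c ⊗ p ⊕ q) ⊕ ⊝ j)) refl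
  ... | inj₁ (_ , alt≡0) | inj₂ (alt≡a , _) = ⊥-elim (a≢0 (trans (sym alt≡a) alt≡0))
  ... | inj₂ (_ , alt≡a) | inj₁ (alt≡0 , _) = ⊥-elim (a≢0 (trans (sym alt≡a) alt≡0))

  module GreedyExpansion (α : Zθ) (α<0 : Positive (-' α)) (J : ℤ) (α+θ^J>0 : Positive (α +' pow J)) where

    index : ℕ → ℤ
    index t = J - + suc t

    remainder : ℕ → Zθ
    remainder zero    = α +' pow J
    remainder (suc t) = greedyRest (remainder t) (index t)

    digitAt : ℕ → ℕ
    digitAt t = greedyDigit (remainder t) (index t)

    index+1 : ∀ t → index t + + 1 ≡ J - + t
    index+1 t = eq J (+ t)
      where
      eq : ∀ J t → J - (+ 1 + t) + + 1 ≡ J - t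
      eq = solve-∀

    index-suc : ∀ t → index (suc t) ≡ index t - + 1
    index-suc t = eq J (+ t)
      where
      eq : ∀ J t → J - (+ 1 + (+ 1 + t)) ≡ J - (+ 1 + t) - + 1
      eq = solve-∀

    remainder-bounds : ∀ t → NonNegative (remainder t) × Positive (pow (J - + t) -' remainder t)
    remainder-step : ∀ t → NonNegative (remainder (suc t)) × Positive (pow (index t) -' remainder (suc t)) ×
                           (digitAt t ≡ a → Positive (pow (index t - + 1) -' remainder (suc t)))

    remainder-bounds zero    = inj₁ α+θ^J>0 , positive-as (trans (cong (λ i → pow i -' (α +' pow J)) (ℤ.+-identityʳ J))
                                                (solve 2 (λ p x → p ⊕ ⊝ (x ⊕ p) ⊜ ⊝ x) refl (pow J) α)) α<0
    remainder-bounds (suc t) = proj₁ (remainder-step t) , proj₁ (proj₂ (remainder-step t))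
    remainder-step t = greedyRest-bounds (remainder t) (index t) (proj₁ (remainder-bounds t))
                         (subst (λ i → Positive (pow i -' remainder t)) (sym (index+1 t)) (proj₂ (remainder-bounds t)))

    digitAt≤a : ∀ t → digitAt t ℕ.≤ a
    digitAt≤a t = IsLargestDigit.d≤b (largestDigit-spec a (remainder t) (index t) (proj₁ (remainder-bounds t)))

    digitAt-greedy : ∀ t → digitAt t ≡ a → digitAt (suc t) ≡ 0
    digitAt-greedy t d≡a = greedyDigit≡0 (remainder (suc t)) (index (suc t)) (proj₁ (remainder-bounds (suc t)))
      (subst (λ i → Positive (pow i -' remainder (suc t))) (sym (index-suc t)) (proj₂ (proj₂ (remainder-step t)) d≡a))

    remainder≡0-step : ∀ t → remainder t ≡ 0θ → digitAt t ≡ 0 × remainder (suc t) ≡ 0θ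
    remainder≡0-step t R≡0 = d≡0 , (begin
      remainder t -' fromℤ (+ digitAt t) *' pow (index t)   ≡⟨ cong₂ (λ r d → r -' fromℤ (+ d) *' pow (index t)) R≡0 d≡0 ⟩
      0θ -' fromℤ (+ 0) *' pow (index t)                  ≡⟨ solve 1 (λ p → Κ 0θ ⊕ ⊝ (Κ (fromℤ (+ 0)) ⊗ p) ⊜ Κ 0θ) refl (pow (index t)) ⟩
      0θ                                                  ∎)
      where
      open ≡-Reasoning
      d≡0 : digitAt t ≡ 0
      d≡0 = trans (cong (λ r → greedyDigit r (index t)) R≡0)
              (greedyDigit≡0 0θ (index t) (inj₂ refl) (positive-as (+'-identityʳ _) (Positive-pow (index t))))

    remainder≡0-from : ∀ T → remainder T ≡ 0θ → ∀ u → remainder (u ℕ.+ T) ≡ 0θ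
    remainder≡0-from T R≡0 zero    = R≡0
    remainder≡0-from T R≡0 (suc u) = proj₂ (remainder≡0-step (u ℕ.+ T) (remainder≡0-from T R≡0 u))

    coefficient : ℤ → ℕ
    coefficient i with i ℤ.<? J
    ... | yes _ = digitAt ℤ.∣ J - + 1 - i ∣
    ... | no  _ = alternating ℤ.∣ i - J ∣

    index<J : ∀ t → index t ℤ.< J
    index<J t = subst (index t ℤ.<_) (ℤ.+-identityʳ J) (ℤ.+-monoʳ-< J ℤ.-<+)

    coefficient-index : ∀ t → coefficient (index t) ≡ digitAt t
    coefficient-index t with index t ℤ.<? J
    ... | yes _        = cong (λ i → digitAt ℤ.∣ i ∣) (eq J (+ t))
      where
      eq : ∀ J t → J - + 1 - (J - (+ 1 + t)) ≡ t
      eq = solve-∀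
    ... | no  index≮J = ⊥-elim (index≮J (index<J t))

    coefficient-tail : ∀ u → coefficient (J + + u) ≡ alternating u
    coefficient-tail u with J + + u ℤ.<? J
    ... | no  _    = cong (λ i → alternating ℤ.∣ i ∣) (eq J (+ u))
      where
      eq : ∀ J u → J + u - J ≡ u
      eq = solve-∀
    ... | yes J+u<J = ⊥-elim (ℤ.<-irrefl refl (ℤ.≤-<-trans (ℤ.i≤i+j J (+ u)) J+u<J))

    index-or-tail : ∀ i → (∃[ t ] i ≡ index t) ⊎ (∃[ u ] i ≡ J + + u)
    index-or-tail i with i ℤ.<? J
    ... | yes i<J = inj₁ (ℤ.∣ J - + 1 - i ∣ , sym (trans (cong (λ n → J - (+ 1 + n)) (ℤ.0≤i⇒+∣i∣≡i 0≤J-1-i)) (eq J i)))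
      where
      eq : ∀ J i → J - (+ 1 + (J - + 1 - i)) ≡ i
      eq = solve-∀
      0≤J-1-i : + 0 ℤ.≤ J - + 1 - i
      0≤J-1-i = subst (+ 0 ℤ.≤_) (regroup J i) (ℤ.i≤j⇒0≤j-i (ℤ.i<j⇒suc[i]≤j i<J))
        where
        regroup : ∀ J i → J - (+ 1 + i) ≡ J - + 1 - i
        regroup = solve-∀
    ... | no  i≮J = inj₂ (ℤ.∣ i - J ∣ , sym (trans (cong (ℤ._+_ J) (ℤ.0≤i⇒+∣i∣≡i (ℤ.i≤j⇒0≤j-i (ℤ.≮⇒≥ i≮J)))) (eq J i)))
      where
      eq : ∀ J i → J + (i - J) ≡ i
      eq = solve-∀

    coefficient-greedy : Greedy coefficient
    coefficient-greedy = ≤a , a⇒prev0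
      where
      ≤a : ∀ i → coefficient i ℕ.≤ a
      ≤a i with index-or-tail i
      ... | inj₁ (t , refl) = subst (ℕ._≤ a) (sym (coefficient-index t)) (digitAt≤a t)
      ... | inj₂ (u , refl) with alternating-step u
      ...   | inj₁ (alt≡0 , _) = subst (ℕ._≤ a) (sym (trans (coefficient-tail u) alt≡0)) z≤n
      ...   | inj₂ (alt≡a , _) = subst (ℕ._≤ a) (sym (trans (coefficient-tail u) alt≡a)) ℕ.≤-refl
      a⇒prev0 : ∀ i → coefficient i ≡ a → coefficient (i - + 1) ≡ 0
      a⇒prev0 i c≡a with index-or-tail i
      ... | inj₁ (t , refl) = trans (cong coefficient (sym (index-suc t)))
                                (trans (coefficient-index (suc t)) (digitAt-greedy t (trans (sym (coefficient-index t)) c≡a)))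
      ... | inj₂ (zero , refl) = ⊥-elim (a≢0 (trans (sym c≡a) (coefficient-tail 0)))
      ... | inj₂ (suc u , refl) with alternating-step u
      ...   | inj₁ (alt≡0 , _)  = trans (cong coefficient (eq J (+ u))) (trans (coefficient-tail u) alt≡0)
        where
        eq : ∀ J u → J + (+ 1 + u) - + 1 ≡ J + u
        eq = solve-∀
      ...   | inj₂ (_ , alt′≡0) = ⊥-elim (a≢0 (trans (sym c≡a) (trans (coefficient-tail (suc u)) alt′≡0)))

    remainder≡ : ∀ t → remainder t ≡ (α +' pow J) -' sumFrom coefficient (J - + t) t
    remainder≡ zero    = sym (+'-identityʳ _)
    remainder≡ (suc t) = begin
      remainder t -' d                                           ≡⟨ cong (_-' d) (remainder≡ t) ⟩
      C -' sumFrom coefficient (J - + t) t -' d                  ≡⟨ solve 3 (λ c s x → c ⊕ ⊝ s ⊕ ⊝ x ⊜ (c ⊕ ⊝ (x ⊕ s))) refl C _ d ⟩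
      C -' (d +' sumFrom coefficient (J - + t) t)                ≡⟨ cong (λ y → C -' y) (sym sumFrom-index) ⟩
      C -' sumFrom coefficient (index t) (suc t)                 ∎
      where
      open ≡-Reasoning
      C d : Zθ
      C = α +' pow J
      d = fromℤ (+ digitAt t) *' pow (index t)
      sumFrom-index : sumFrom coefficient (index t) (suc t) ≡ d +' sumFrom coefficient (J - + t) t
      sumFrom-index = cong₂ _+'_ (trans (mulθ≡*' (fromℤ (+ coefficient (index t))) (pow (index t))) (cong (λ e → fromℤ (+ e) *' pow (index t)) (coefficient-index t)))
                                 (cong (λ i → sumFrom coefficient i t) (index+1 t))

    -- Scaling the t-th remainder by θ^(t-J) gives an integer z in [0,1) whose
    -- conjugate is -σ(value of the digits) up to 1/θ², so z ∈ {0, 1/θ}.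
    module Termination where
      C : Zθ
      c u t : ℕ
      ds : List ℕ
      z : Zθ
      C = α +' pow J
      c = proj₁ (archimedean (σ C))
      u = c ℕ.+ (2 ℕ.+ ℤ.∣ J ∣)
      t = ℤ.∣ J + + u ∣
      ds = digitsFrom coefficient (J - + t) t
      z = pow (+ u) *' remainder t

      J-t≡-u : J - + t ≡ - + u
      J-t≡-u = trans (cong (ℤ._-_ J) (ℤ.0≤i⇒+∣i∣≡i 0≤J+u)) (eq J (+ u))
        where
        eq : ∀ J u → J - (J + u) ≡ - u
        eq = solve-∀
        0≤J+∣J∣ : ∀ J → + 0 ℤ.≤ J + + ℤ.∣ J ∣
        0≤J+∣J∣ (+ n)    = +≤+ z≤n
        0≤J+∣J∣ -[1+ n ] = ℤ.≤-reflexive (sym (ℤ.n⊖n≡0 (suc n)))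
        0≤J+u : + 0 ℤ.≤ J + + u
        0≤J+u = subst (+ 0 ℤ.≤_) (regroup J (+ ℤ.∣ J ∣) (+ c)) (ℤ.+-mono-≤ (0≤J+∣J∣ J) (+≤+ (z≤n {c ℕ.+ 2})))
          where
          regroup : ∀ J v c → J + v + (c + (+ 1 + + 1)) ≡ J + (c + (+ 1 + + 1 + v))
          regroup = solve-∀

      θ^u*θ^[J-t]≡1 : pow (+ u) *' pow (J - + t) ≡ 1θ
      θ^u*θ^[J-t]≡1 = trans (cong (λ i → pow (+ u) *' pow i) J-t≡-u) (trans (*'-comm (pow (+ u)) _) (pow-inverse (+ u)))

      z≡ : z ≡ pow (+ u) *' C -' value ds
      z≡ = begin
        pow (+ u) *' remainder t                                        ≡⟨ cong (pow (+ u) *'_) (trans (remainder≡ t) (cong (λ y → C -' y) (sumFrom≡pow*value coefficient (J - + t) t))) ⟩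
        pow (+ u) *' (C -' pow (J - + t) *' value ds)                   ≡⟨ solve 4 (λ q c p v → q ⊗ (c ⊕ ⊝ (p ⊗ v)) ⊜ (q ⊗ c ⊕ ⊝ ((q ⊗ p) ⊗ v))) refl (pow (+ u)) C (pow (J - + t)) (value ds) ⟩
        pow (+ u) *' C -' (pow (+ u) *' pow (J - + t)) *' value ds      ≡⟨ cong (λ y → pow (+ u) *' C -' y *' value ds) θ^u*θ^[J-t]≡1 ⟩
        pow (+ u) *' C -' 1θ *' value ds                                ≡⟨ cong (λ y → pow (+ u) *' C -' y) (*'-identityˡ (value ds)) ⟩
        pow (+ u) *' C -' value ds                                      ∎
        where open ≡-Reasoning

      z≥0 : NonNegative z
      z≥0 = NonNegative-pow* (+ u) (proj₁ (remainder-bounds t))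

      z<1 : Positive (1θ -' z)
      z<1 = positive-as (trans (cong (_-' z) (sym θ^u*θ^[J-t]≡1)) (factor (pow (+ u)) (pow (J - + t)) (remainder t)))
              (Positive-pow* (+ u) (proj₂ (remainder-bounds t)))
        where
        factor : ∀ q p r → q *' p -' q *' r ≡ q *' (p -' r)
        factor = solve 3 (λ q p r → q ⊗ p ⊕ ⊝ (q ⊗ r) ⊜ q ⊗ (p ⊕ ⊝ r)) refl

      |σ[θ^u*C]|<1/θ² : ∣ σ (pow (+ u) *' C) ∣< 1/θ²
      |σ[θ^u*C]|<1/θ² = ∣σ-pow*∣<1/θ² c ℤ.∣ J ∣ (bounded (proj₁ (proj₂ (archimedean (σ C))))
                           (positive-as (+'-comm (σ C) (pow (+ c))) (proj₂ (proj₂ (archimedean (σ C))))))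

      σ-value-window : InWindow (σ (value ds))
      σ-value-window = σ-value-inWindow _ ds (digitsFrom-greedy coefficient coefficient-greedy t (J - + t))

      σz≡ : σ z ≡ σ (pow (+ u) *' C) -' σ (value ds)
      σz≡ = trans (cong σ z≡) (σ-sub (pow (+ u) *' C) (value ds))

      σz>-θ-1/θ² : Positive (σ z +' θ +' 1/θ²)
      σz>-θ-1/θ² = positive-as (trans (cong (λ y → y +' θ +' 1/θ²) σz≡) (regroup (σ (pow (+ u) *' C)) (σ (value ds)) θ 1/θ²))
                     (Positive-+ (∣_∣<_.lower |σ[θ^u*C]|<1/θ²) (proj₂ σ-value-window))
        where
        regroup : ∀ s w t e → s -' w +' t +' e ≡ (s +' e) +' (t -' w)
        regroup = solve 4 (λ s w t e → s ⊕ ⊝ w ⊕ t ⊕ e ⊜ ((s ⊕ e) ⊕ (t ⊕ ⊝ w))) refl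

      σz<1+1/θ² : Positive (1θ +' 1/θ² -' σ z)
      σz<1+1/θ² = positive-as (trans (cong (λ y → 1θ +' 1/θ² -' y) σz≡) (regroup (σ (pow (+ u) *' C)) (σ (value ds)) 1/θ²))
                    (Positive-+ (∣_∣<_.upper |σ[θ^u*C]|<1/θ²) (proj₁ σ-value-window))
        where
        regroup : ∀ s w e → 1θ +' e -' (s -' w) ≡ (e -' s) +' (w +' 1θ)
        regroup = solve 3 (λ s w e → Κ 1θ ⊕ e ⊕ ⊝ (s ⊕ ⊝ w) ⊜ ((e ⊕ ⊝ s) ⊕ (w ⊕ Κ 1θ))) refl

      remainder≡θ^[J-t]*z : remainder t ≡ pow (J - + t) *' z
      remainder≡θ^[J-t]*z = sym (begin
        pow (J - + t) *' (pow (+ u) *' remainder t)   ≡⟨ *'-assoc (pow (J - + t)) (pow (+ u)) (remainder t) ⟨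
        (pow (J - + t) *' pow (+ u)) *' remainder t   ≡⟨ cong (_*' remainder t) (trans (*'-comm (pow (J - + t)) (pow (+ u))) θ^u*θ^[J-t]≡1) ⟩
        1θ *' remainder t                             ≡⟨ *'-identityˡ (remainder t) ⟩
        remainder t                                   ∎)
        where open ≡-Reasoning

      finish : z ≡ 0θ ⊎ z ≡ 1/θ → ∃[ T ] remainder T ≡ 0θ
      finish (inj₁ z≡0)   = t , trans remainder≡θ^[J-t]*z (trans (cong (pow (J - + t) *'_) z≡0) (*'-zeroʳ (pow (J - + t))))
      finish (inj₂ z≡1/θ) = suc t , (begin
        greedyRest (remainder t) (index t)                        ≡⟨ cong (λ r → greedyRest r (index t)) remainder≡θ^index ⟩
        pow (index t) -' fromℤ (+ greedyDigit (pow (index t)) (index t)) *' pow (index t)  ≡⟨ cong (λ e → pow (index t) -' fromℤ (+ e) *' pow (index t)) (greedyDigit-pow (index t)) ⟩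
        pow (index t) -' fromℤ (+ 1) *' pow (index t)             ≡⟨ solve 1 (λ p → p ⊕ ⊝ (Κ 1θ ⊗ p) ⊜ Κ 0θ) refl (pow (index t)) ⟩
        0θ                                                        ∎)
        where
        open ≡-Reasoning
        remainder≡θ^index : remainder t ≡ pow (index t)
        remainder≡θ^index = begin
          remainder t                 ≡⟨ remainder≡θ^[J-t]*z ⟩
          pow (J - + t) *' z          ≡⟨ cong (pow (J - + t) *'_) z≡1/θ ⟩
          pow (J - + t) *' 1/θ        ≡⟨ *'-comm (pow (J - + t)) 1/θ ⟩
          1/θ *' pow (J - + t)        ≡⟨ pow-pred (J - + t) ⟨
          pow (J - + t - + 1)         ≡⟨ cong pow (eq J (+ t)) ⟩
          pow (index t)               ∎
          where
          eq : ∀ J t → J - t - + 1 ≡ J - (+ 1 + t)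
          eq = solve-∀

      result : ∃[ T ] remainder T ≡ 0θ
      result = finish (unit-interval-lattice-points z z≥0 z<1 σz>-θ-1/θ² σz<1+1/θ²)

    opaque
      termination : ∃[ T ] remainder T ≡ 0θ
      termination = Termination.result

    stop : ℕ
    stop = proj₁ termination

    lowest : ℤ
    lowest = J - + stop

    coefficient-below : ∀ i → i ℤ.< lowest → coefficient i ≡ 0
    coefficient-below i i<lowest with index-or-tail i
    ... | inj₂ (u , refl) = ⊥-elim (ℤ.<-irrefl refl (ℤ.<-≤-trans i<lowest (ℤ.≤-trans (ℤ.i-j≤i J (+ stop)) (ℤ.i≤i+j J (+ u)))))
    ... | inj₁ (t , refl) = trans (coefficient-index t)
        (proj₁ (remainder≡0-step t (subst (λ n → remainder n ≡ 0θ) (ℕ.m∸n+n≡m stop≤t) (remainder≡0-from stop (proj₂ termination) (t ℕ.∸ stop)))))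
      where
      stop≤t : stop ℕ.≤ t
      stop≤t = ℕ.≮⇒≥ (λ t<stop → ℤ.<-irrefl refl (ℤ.<-≤-trans i<lowest (ℤ.+-monoʳ-≤ J (ℤ.neg-mono-≤ (+≤+ t<stop)))))

    series : GLS a
    series = record
      { coeff = coefficient ; start = lowest ; below = coefficient-below
      ; digit = proj₁ coefficient-greedy ; greedy = proj₂ coefficient-greedy }

    lowest+stop≡J : lowest + + stop ≡ J
    lowest+stop≡J = eq J (+ stop)
      where
      eq : ∀ J s → J - s + s ≡ J
      eq = solve-∀

    sumFrom-lowest : sumFrom coefficient lowest stop ≡ α +' pow J
    sumFrom-lowest = begin
      sumFrom coefficient lowest stop                                  ≡⟨ solve 2 (λ c s → s ⊜ (c ⊕ ⊝ (c ⊕ ⊝ s))) refl (α +' pow J) _ ⟩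
      (α +' pow J) -' ((α +' pow J) -' sumFrom coefficient lowest stop) ≡⟨ cong (λ y → (α +' pow J) -' y) (trans (sym (remainder≡ stop)) (proj₂ termination)) ⟩
      (α +' pow J) -' 0θ                                               ≡⟨ +'-identityʳ (α +' pow J) ⟩
      α +' pow J                                                       ∎
      where open ≡-Reasoning

    overshoot : ∀ n → stop ℕ.≤ n → Overshoot α (lowest + + n) (sumFrom coefficient lowest n)
    overshoot n stop≤n = subst (λ m → Overshoot α (lowest + + m) (sumFrom coefficient lowest m)) (ℕ.m+[n∸m]≡n stop≤n) (shifted (n ℕ.∸ stop))
      where
      open ≡-Reasoning
      index≡ : ∀ w → lowest + + (stop ℕ.+ w) ≡ J + + w
      index≡ w = trans (cong (ℤ._+_ lowest) (ℤ.pos-+ stop w)) (trans (sym (ℤ.+-assoc lowest (+ stop) (+ w))) (cong (_+ + w) lowest+stop≡J))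
      split : ∀ w → sumFrom coefficient lowest (stop ℕ.+ w) ≡ (α +' pow J) +' sumFrom coefficient J w
      split w = trans (sumFrom-+ coefficient stop lowest w) (cong₂ _+'_ sumFrom-lowest (cong (λ i → sumFrom coefficient i w) lowest+stop≡J))
      add : ∀ p → (α +' pow J) +' (p -' pow J) ≡ α +' p
      add p = solve 3 (λ x q p → (x ⊕ q) ⊕ (p ⊕ ⊝ q) ⊜ (x ⊕ p)) refl α (pow J) p
      shifted : ∀ w → Overshoot α (lowest + + (stop ℕ.+ w)) (sumFrom coefficient lowest (stop ℕ.+ w))
      shifted w with alternating-sumFrom coefficient J coefficient-tail w
      ... | inj₁ (S≡ , _) = inj₁ (trans (split w) (trans (cong ((α +' pow J) +'_) S≡) (trans (add (pow (J + + w))) (cong (λ i → α +' pow i) (sym (index≡ w))))))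
      ... | inj₂ (S≡ , _) = inj₂ (trans (split w) (trans (cong ((α +' pow J) +'_) S≡) (trans (add (pow (J + + w - + 1))) (cong (λ i → α +' pow (i - + 1)) (sym (index≡ w))))))

    inClass : InClass series α
    inClass k = N , close
      where
      c N : ℕ
      c = ℤ.∣ k - J ∣
      N = stop ℕ.+ suc c
      k≤J+c : k ℤ.≤ J + + c
      k≤J+c = subst (ℤ._≤ J + + c) (eq J k) (ℤ.+-monoʳ-≤ J (i≤∣i∣ (k - J)))
        where
        eq : ∀ J k → J + (k - J) ≡ k
        eq = solve-∀
        i≤∣i∣ : ∀ i → i ℤ.≤ + ℤ.∣ i ∣
        i≤∣i∣ (+ n)    = ℤ.≤-refl
        i≤∣i∣ -[1+ n ] = ℤ.-≤+
      J+c≡ : J + + c ≡ lowest + + N - + 1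
      J+c≡ = trans (eq J (+ stop) (+ c)) (cong (λ i → lowest + i - + 1) (sym (ℤ.pos-+ stop (suc c))))
        where
        eq : ∀ J s c → J + c ≡ J - s + (s + (+ 1 + c)) - + 1
        eq = solve-∀
      close : ∀ n → N ℕ.≤ n → AbsLe a (subθ (partialSum series n) α) k
      close n N≤n = subst (λ x → AbsLe a x k) (sym (cong (_-' α) (partialSum≡sumFrom series n)))
                      (overshoot⇒close (overshoot n (ℕ.≤-trans (ℕ.m≤m+n stop (suc c)) N≤n)))
        where
        k≤m-1 : k ℤ.≤ lowest + + n - + 1
        k≤m-1 = ℤ.≤-trans k≤J+c (subst (ℤ._≤ lowest + + n - + 1) (sym J+c≡) (ℤ.+-monoˡ-≤ (- + 1) (ℤ.+-monoʳ-≤ lowest (+≤+ N≤n))))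
        cancel : ∀ p → α +' p -' α ≡ p
        cancel p = solve 2 (λ x p → x ⊕ p ⊕ ⊝ x ⊜ p) refl α p
        overshoot⇒close : Overshoot α (lowest + + n) (sumFrom coefficient lowest n) → AbsLe a (sumFrom coefficient lowest n -' α) k
        overshoot⇒close (inj₁ S≡) = subst (λ x → AbsLe a x k) (sym (trans (cong (_-' α) S≡) (cancel _)))
                                      (AbsLe-pow (ℤ.≤-trans k≤m-1 (ℤ.i-j≤i (lowest + + n) (+ 1))))
        overshoot⇒close (inj₂ S≡) = subst (λ x → AbsLe a x k) (sym (trans (cong (_-' α) S≡) (cancel _))) (AbsLe-pow k≤m-1)

module Uniqueness (a : ℕ) (1≤a : 1 ℕ.≤ a) where
  open QuadraticIntegers a
  open Positivity a 1≤a
  open GreedySums a 1≤a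
  open LatticePoints a 1≤a
  open ConjugateDecay a 1≤a

  -- If x = ±θ^m·(greedy digits) with m ≥ j + 3, then θ^(-j)x = ±θ^(m-j)·(digits)
  -- and the conjugate of the digits lies in (-1, θ).
  ∣σ-θ^-j*polyVal∣<1/θ² : ∀ j m ds → j + + 3 ℤ.≤ m → GreedyDigits a ds → ∣ σ (pow (- j) *' polyVal a m ds) ∣< 1/θ²
  ∣σ-θ^-j*polyVal∣<1/θ² j m ds j+3≤m greedy-ds =
    subst (∣_∣< 1/θ²) (cong σ (sym θ^-j*ds)) (∣σ-pow*∣<1/θ² 1 e (InWindow⇒∣-∣<θ (σ-value-inWindow 0 ds greedy-ds)))
    where
    e = ℤ.∣ m - j - + 3 ∣
    -j+m≡ : - j + m ≡ + (1 ℕ.+ (2 ℕ.+ e))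
    -j+m≡ = trans (eq j m) (cong (ℤ._+_ (+ 3)) (sym (ℤ.0≤i⇒+∣i∣≡i 0≤m-j-3)))
      where
      eq : ∀ j m → - j + m ≡ + 3 + (m - j - + 3)
      eq = solve-∀
      0≤m-j-3 : + 0 ℤ.≤ m - j - + 3
      0≤m-j-3 = subst (+ 0 ℤ.≤_) (eq′ j m) (ℤ.i≤j⇒0≤j-i j+3≤m)
        where
        eq′ : ∀ j m → m - (j + + 3) ≡ m - j - + 3
        eq′ = solve-∀
    θ^-j*ds : pow (- j) *' polyVal a m ds ≡ pow (+ (1 ℕ.+ (2 ℕ.+ e))) *' value ds
    θ^-j*ds = begin
      pow (- j) *' polyVal a m ds          ≡⟨ cong (pow (- j) *'_) (polyVal≡pow*value m ds) ⟩
      pow (- j) *' (pow m *' value ds)     ≡⟨ *'-assoc (pow (- j)) (pow m) (value ds) ⟨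
      (pow (- j) *' pow m) *' value ds     ≡⟨ cong (_*' value ds) (trans (sym (pow-+ (- j) m)) (cong pow -j+m≡)) ⟩
      pow (+ (1 ℕ.+ (2 ℕ.+ e))) *' value ds ∎
      where open ≡-Reasoning

  θ-adically-small⇒∣σ∣<1/θ² : ∀ j x → AbsLe a x (j + + 3) → ∣ σ (pow (- j) *' x) ∣< 1/θ²
  θ-adically-small⇒∣σ∣<1/θ² j x (m , ds , j+3≤m , greedy-ds , inj₁ x≡ds) =
    subst (λ z → ∣ σ (pow (- j) *' z) ∣< 1/θ²) (sym x≡ds) (∣σ-θ^-j*polyVal∣<1/θ² j m ds j+3≤m greedy-ds)
  θ-adically-small⇒∣σ∣<1/θ² j x (m , ds , j+3≤m , greedy-ds , inj₂ x≡-ds) =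
    subst (λ z → ∣ σ (pow (- j) *' z) ∣< 1/θ²) (sym x≡-ds)
      (subst (∣_∣< 1/θ²) (sym σ-neg-pull) (∣-∣<-neg (∣σ-θ^-j*polyVal∣<1/θ² j m ds j+3≤m greedy-ds)))
    where
    σ-neg-pull : σ (pow (- j) *' negθ (polyVal a m ds)) ≡ -' σ (pow (- j) *' polyVal a m ds)
    σ-neg-pull = trans (cong σ (sym (-'-distribʳ-*' (pow (- j)) (polyVal a m ds)))) (σ-neg (pow (- j) *' polyVal a m ds))

  -- For n large, r = θ^(-j)(α - Sₙ) with j = s + n lies in (-1 - 1/θ², 0); its
  -- conjugate is σ(value of the digits after j) up to the conjugate of the
  -- θ-adically tiny error θ^(-j)(S_{n+N} - α), so the lattice lemma applies.
  module Overshooting (α : Zθ) (α<0 : Positive (-' α)) (y : GLS a) (y∈α : InClass y α) where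
    f : ℤ → ℕ
    s : ℤ
    c n₀ : ℕ
    f = coeff y
    s = start y
    c = proj₁ (archimedean (-' α))
    n₀ = ℤ.∣ + c + + 2 - s ∣

    module AtStep (n : ℕ) (n₀≤n : n₀ ℕ.≤ n) where
      j : ℤ
      P Q : Zθ
      N : ℕ
      Sₙ E tail r : Zθ
      j = s + + n
      P = pow j
      Q = pow (- j)
      N = proj₁ (y∈α (j + + 3))
      Sₙ = sumFrom f s n
      E = sumFrom f s (n ℕ.+ N) -' α
      tail = value (digitsFrom f j N)
      r = Q *' (α -' Sₙ)

      r≡tail-QE : r ≡ tail -' Q *' E
      r≡tail-QE = begin
        Q *' (α -' Sₙ)                                      ≡⟨ regroup Q P tail α Sₙ ⟩
        (Q *' P) *' tail -' Q *' ((Sₙ +' P *' tail) -' α)   ≡⟨ cong₂ (λ u v → u *' tail -' Q *' (v -' α)) (pow-inverse j) (sym S[n+N]≡) ⟩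
        1θ *' tail -' Q *' E                                ≡⟨ cong (_-' Q *' E) (*'-identityˡ tail) ⟩
        tail -' Q *' E                                      ∎
        where
        open ≡-Reasoning
        regroup : ∀ q p t α s → q *' (α -' s) ≡ (q *' p) *' t -' q *' ((s +' p *' t) -' α)
        regroup = solve 5 (λ q p t α s → q ⊗ (α ⊕ ⊝ s) ⊜ ((q ⊗ p) ⊗ t ⊕ ⊝ (q ⊗ ((s ⊕ p ⊗ t) ⊕ ⊝ α)))) refl
        S[n+N]≡ : sumFrom f s (n ℕ.+ N) ≡ Sₙ +' P *' tail
        S[n+N]≡ = trans (sumFrom-+ f n s N) (cong (Sₙ +'_) (sumFrom≡pow*value f j N))

      r<0 : Positive (-' r)
      r<0 = positive-as (negate Q α Sₙ) (Positive-pow* (- j) (NonNegative-+-Positive (sumFrom-nonNegative f s n) α<0))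
        where
        negate : ∀ q α s → -' (q *' (α -' s)) ≡ q *' (s +' -' α)
        negate = solve 3 (λ q α s → ⊝ (q ⊗ (α ⊕ ⊝ s)) ⊜ q ⊗ (s ⊕ ⊝ α)) refl

      Q*θ^[j-2]≡1/θ² : Q *' pow (j - + 2) ≡ 1/θ²
      Q*θ^[j-2]≡1/θ² = begin
        Q *' pow (j - + 2)         ≡⟨ pow-+ (- j) (j - + 2) ⟨
        pow (- j + (j - + 2))      ≡⟨ cong pow (eq j) ⟩
        pow -[1+ 1 ]               ≡⟨ trans (mulθ≡*' 1/θ _) (cong (1/θ *'_) (trans (mulθ≡*' 1/θ 1θ) (*'-identityʳ 1/θ))) ⟩
        1/θ²                       ∎
        where
        open ≡-Reasoning
        eq : ∀ j → - j + (j - + 2) ≡ - + 2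
        eq = solve-∀

      -α<θ^[j-2] : Positive (α +' pow (j - + 2))
      -α<θ^[j-2] = positive-as (regroup α (pow (+ c)) (pow (j - + 2)))
                     (NonNegative-+-Positive θ^c≤θ^[j-2] (proj₁ (proj₂ (archimedean (-' α)))))
        where
        regroup : ∀ α p q → α +' q ≡ (q -' p) +' (p -' -' α)
        regroup = solve 3 (λ α p q → α ⊕ q ⊜ ((q ⊕ ⊝ p) ⊕ (p ⊕ ⊝ (⊝ α)))) refl
        0≤j-2-c : + 0 ℤ.≤ j - + 2 - + c
        0≤j-2-c = subst (+ 0 ℤ.≤_) (eq s (+ n) (+ c)) (ℤ.i≤j⇒0≤j-i (ℤ.≤-trans (i≤∣i∣ (+ c + + 2 - s)) (+≤+ n₀≤n)))
          where
          eq : ∀ s n c → n - (c + + 2 - s) ≡ s + n - + 2 - c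
          eq = solve-∀
          i≤∣i∣ : ∀ i → i ℤ.≤ + ℤ.∣ i ∣
          i≤∣i∣ (+ m)    = ℤ.≤-refl
          i≤∣i∣ -[1+ m ] = ℤ.-≤+
        θ^c≤θ^[j-2] : NonNegative (pow (j - + 2) -' pow (+ c))
        θ^c≤θ^[j-2] = subst (λ i → NonNegative (pow i -' pow (+ c))) (trans (cong (ℤ._+_ (+ c)) (ℤ.0≤i⇒+∣i∣≡i 0≤j-2-c)) (eq j (+ c)))
                        (pow-mono (+ c) ℤ.∣ j - + 2 - + c ∣)
          where
          eq : ∀ j c → c + (j - + 2 - c) ≡ j - + 2
          eq = solve-∀

      r>-1-1/θ² : Positive (r +' 1θ +' 1/θ²)
      r>-1-1/θ² = positive-as (trans (cong₂ (λ u v → r +' u +' v) (sym (pow-inverse j)) (sym Q*θ^[j-2]≡1/θ²)) (regroup Q α Sₙ P (pow (j - + 2))))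
                    (Positive-+ (Positive-pow* (- j) (sumFrom<pow f (digit y , greedy y) s n)) (Positive-pow* (- j) -α<θ^[j-2]))
        where
        regroup : ∀ q α s p p₂ → q *' (α -' s) +' q *' p +' q *' p₂ ≡ q *' (p -' s) +' q *' (α +' p₂)
        regroup = solve 5 (λ q α s p p₂ → q ⊗ (α ⊕ ⊝ s) ⊕ q ⊗ p ⊕ q ⊗ p₂ ⊜ (q ⊗ (p ⊕ ⊝ s) ⊕ q ⊗ (α ⊕ p₂))) refl

      |σ[QE]|<1/θ² : ∣ σ (Q *' E) ∣< 1/θ²
      |σ[QE]|<1/θ² = θ-adically-small⇒∣σ∣<1/θ² j E (subst (λ x → AbsLe a x (j + + 3)) E≡ (proj₂ (y∈α (j + + 3)) (n ℕ.+ N) (ℕ.m≤n+m N n)))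
        where
        E≡ : subθ (partialSum y (n ℕ.+ N)) α ≡ E
        E≡ = cong (_-' α) (partialSum≡sumFrom y (n ℕ.+ N))

      σ-tail-window : InWindow (σ tail)
      σ-tail-window = σ-value-inWindow (f (j - + 1)) (digitsFrom f j N) (digitsFrom-greedy f (digit y , greedy y) N j)

      σr≡ : σ r ≡ σ tail -' σ (Q *' E)
      σr≡ = trans (cong σ r≡tail-QE) (σ-sub tail (Q *' E))

      σr<θ+1/θ² : Positive (θ +' 1/θ² -' σ r)
      σr<θ+1/θ² = positive-as (trans (cong (λ x → θ +' 1/θ² -' x) σr≡) (regroup (σ tail) (σ (Q *' E)) θ 1/θ²))
                    (Positive-+ (proj₂ σ-tail-window) (∣_∣<_.lower |σ[QE]|<1/θ²))
        where
        regroup : ∀ w e t u → t +' u -' (w -' e) ≡ (t -' w) +' (e +' u)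
        regroup = solve 4 (λ w e t u → t ⊕ u ⊕ ⊝ (w ⊕ ⊝ e) ⊜ ((t ⊕ ⊝ w) ⊕ (e ⊕ u))) refl

      σr>-1-1/θ² : Positive (σ r +' 1θ +' 1/θ²)
      σr>-1-1/θ² = positive-as (trans (cong (λ x → x +' 1θ +' 1/θ²) σr≡) (regroup (σ tail) (σ (Q *' E)) 1/θ²))
                     (Positive-+ (proj₁ σ-tail-window) (∣_∣<_.upper |σ[QE]|<1/θ²))
        where
        regroup : ∀ w e u → w -' e +' 1θ +' u ≡ (w +' 1θ) +' (u -' e)
        regroup = solve 3 (λ w e u → w ⊕ ⊝ e ⊕ Κ 1θ ⊕ u ⊜ ((w ⊕ Κ 1θ) ⊕ (u ⊕ ⊝ e))) refl

      Sₙ≡α-P*r : Sₙ ≡ α -' P *' r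
      Sₙ≡α-P*r = begin
        Sₙ                        ≡⟨ regroup α Sₙ ⟩
        α -' (α -' Sₙ)            ≡⟨ cong (λ x → α -' x) (sym P*r) ⟩
        α -' P *' r               ∎
        where
        open ≡-Reasoning
        regroup : ∀ α s → s ≡ α -' (α -' s)
        regroup = solve 2 (λ α s → s ⊜ (α ⊕ ⊝ (α ⊕ ⊝ s))) refl
        P*r : P *' r ≡ α -' Sₙ
        P*r = trans (sym (*'-assoc P Q (α -' Sₙ))) (trans (cong (_*' (α -' Sₙ)) (trans (*'-comm P Q) (pow-inverse j))) (*'-identityˡ (α -' Sₙ)))

      overshoot : Overshoot α j Sₙ
      overshoot = [ (λ r≡-1 → inj₁ (trans Sₙ≡α-P*r (trans (cong (λ x → α -' P *' x) r≡-1) (trans (sub-neg α P 1θ) (cong (α +'_) (*'-identityʳ P))))))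
                  , (λ r≡-1/θ → inj₂ (trans Sₙ≡α-P*r (trans (cong (λ x → α -' P *' x) r≡-1/θ)
                                     (trans (sub-neg α P 1/θ) (cong (α +'_) (trans (*'-comm P 1/θ) (sym (pow-pred j))))))))
                  ]′ (negative-lattice-points r r<0 r>-1-1/θ² σr<θ+1/θ² σr>-1-1/θ²)
        where
        sub-neg : ∀ α p u → α -' p *' (-' u) ≡ α +' p *' u
        sub-neg = solve 3 (λ α p u → α ⊕ ⊝ (p ⊗ (⊝ u)) ⊜ (α ⊕ p ⊗ u)) refl

  eventually-overshoots : ∀ α → Positive (-' α) → (y : GLS a) → InClass y α →
    ∃[ n₀ ] ∀ n → n₀ ℕ.≤ n → Overshoot α (start y + + n) (sumFrom (coeff y) (start y) n)
  eventually-overshoots α α<0 y y∈α = n₀ , AtStep.overshoot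
    where open Overshooting α α<0 y y∈α

  OvershootsFrom : Zθ → (ℤ → ℕ) → ℤ → ℕ → Set
  OvershootsFrom α g b n₀ = ∀ n → n₀ ℕ.≤ n → Overshoot α (b + + n) (sumFrom g b n)

  private
    *pow-cancelʳ : ∀ j x y → x *' pow j ≡ y *' pow j → x ≡ y
    *pow-cancelʳ j x y x*θʲ≡y*θʲ = trans (sym (undo x)) (trans (cong (_*' pow (- j)) x*θʲ≡y*θʲ) (undo y))
      where
      undo : ∀ z → (z *' pow j) *' pow (- j) ≡ z
      undo z = trans (*'-assoc z (pow j) (pow (- j))) (trans (cong (z *'_) (trans (*'-comm (pow j) (pow (- j))) (pow-inverse j))) (*'-identityʳ z))

    digit-difference≢θ^j[θ-1] : ∀ d e j → fromℤ (+ d) *' pow j -' fromℤ (+ e) *' pow j ≢ pow (j + + 1) -' pow j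
    digit-difference≢θ^j[θ-1] d e j eq = 0≢1 (cong im (*pow-cancelʳ j (fromℤ (+ d) -' fromℤ (+ e)) (θ -' 1θ) (begin
      (fromℤ (+ d) -' fromℤ (+ e)) *' pow j        ≡⟨ factor (fromℤ (+ d)) (fromℤ (+ e)) (pow j) ⟨
      fromℤ (+ d) *' pow j -' fromℤ (+ e) *' pow j ≡⟨ eq ⟩
      pow (j + + 1) -' pow j                       ≡⟨ cong (_-' pow j) (pow-suc j) ⟩
      θ *' pow j -' pow j                          ≡⟨ factor-1 θ (pow j) ⟩
      (θ -' 1θ) *' pow j                           ∎)))
      where
      open ≡-Reasoning
      factor : ∀ d e p → d *' p -' e *' p ≡ (d -' e) *' p
      factor = solve 3 (λ d e p → d ⊗ p ⊕ ⊝ (e ⊗ p) ⊜ (d ⊕ ⊝ e) ⊗ p) refl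
      factor-1 : ∀ t p → t *' p -' p ≡ (t -' 1θ) *' p
      factor-1 = solve 2 (λ t p → t ⊗ p ⊕ ⊝ p ⊜ (t ⊕ ⊝ Κ 1θ) ⊗ p) refl
      0≢1 : + 0 ≢ + 1
      0≢1 ()

    digit*pow-injective : ∀ d e j → fromℤ (+ d) *' pow j ≡ fromℤ (+ e) *' pow j → d ≡ e
    digit*pow-injective d e j eq = cong ℤ.∣_∣ (cong re (*pow-cancelʳ j (fromℤ (+ d)) (fromℤ (+ e)) eq))

    overshoot-type-stable : ∀ α g h b n → sumFrom g b n ≡ sumFrom h b n →
      sumFrom g b (suc n) ≡ α +' pow (b + + suc n) → sumFrom h b (suc n) ≢ α +' pow (b + + suc n - + 1)
    overshoot-type-stable α g h b n same g-high h-low = digit-difference≢θ^j[θ-1] (g k) (h k) k (begin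
      fromℤ (+ g k) *' pow k -' fromℤ (+ h k) *' pow k       ≡⟨ cancel (sumFrom g b n) (fromℤ (+ g k) *' pow k) (fromℤ (+ h k) *' pow k) ⟨
      (sumFrom g b n +' fromℤ (+ g k) *' pow k) -' (sumFrom g b n +' fromℤ (+ h k) *' pow k)
                                                             ≡⟨ cong (λ v → (sumFrom g b n +' fromℤ (+ g k) *' pow k) -' (v +' fromℤ (+ h k) *' pow k)) same ⟩
      (sumFrom g b n +' fromℤ (+ g k) *' pow k) -' (sumFrom h b n +' fromℤ (+ h k) *' pow k)
                                                             ≡⟨ cong₂ _-'_ (sym (sumFrom-suc g b n)) (sym (sumFrom-suc h b n)) ⟩
      sumFrom g b (suc n) -' sumFrom h b (suc n)             ≡⟨ cong₂ _-'_ g-high h-low ⟩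
      (α +' pow (b + + suc n)) -' (α +' pow (b + + suc n - + 1)) ≡⟨ cancel α (pow (b + + suc n)) (pow (b + + suc n - + 1)) ⟩
      pow (b + + suc n) -' pow (b + + suc n - + 1)           ≡⟨ cong₂ (λ i i′ → pow i -' pow i′) (eq₁ b (+ n)) (eq₂ b (+ n)) ⟩
      pow (k + + 1) -' pow k                                 ∎)
      where
      open ≡-Reasoning
      k : ℤ
      k = b + + n
      cancel : ∀ s x y → (s +' x) -' (s +' y) ≡ x -' y
      cancel = solve 3 (λ s x y → (s ⊕ x) ⊕ ⊝ (s ⊕ y) ⊜ (x ⊕ ⊝ y)) refl
      eq₁ : ∀ b n → b + (+ 1 + n) ≡ b + n + + 1
      eq₁ = solve-∀
      eq₂ : ∀ b n → b + (+ 1 + n) - + 1 ≡ b + n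
      eq₂ = solve-∀

    next-sums-agree : ∀ α g h b n → Overshoot α (b + + suc n) (sumFrom g b (suc n)) → Overshoot α (b + + suc n) (sumFrom h b (suc n)) →
      sumFrom g b n ≡ sumFrom h b n → sumFrom g b (suc n) ≡ sumFrom h b (suc n)
    next-sums-agree α g h b n (inj₁ g-high) (inj₁ h-high) _    = trans g-high (sym h-high)
    next-sums-agree α g h b n (inj₂ g-low)  (inj₂ h-low)  _    = trans g-low (sym h-low)
    next-sums-agree α g h b n (inj₁ g-high) (inj₂ h-low)  same = ⊥-elim (overshoot-type-stable α g h b n same g-high h-low)
    next-sums-agree α g h b n (inj₂ g-low)  (inj₁ h-high) same = ⊥-elim (overshoot-type-stable α h g b n (sym same) h-high g-low)

    digit-from-sums : ∀ g h b n → sumFrom g b n ≡ sumFrom h b n → sumFrom g b (suc n) ≡ sumFrom h b (suc n) → g (b + + n) ≡ h (b + + n)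
    digit-from-sums g h b n same same′ = digit*pow-injective (g (b + + n)) (h (b + + n)) (b + + n) (begin
      fromℤ (+ g (b + + n)) *' pow (b + + n)                         ≡⟨ cancel (sumFrom g b n) _ ⟨
      (sumFrom g b n +' fromℤ (+ g (b + + n)) *' pow (b + + n)) -' sumFrom g b n ≡⟨ cong₂ _-'_ (trans (sym (sumFrom-suc g b n)) (trans same′ (sumFrom-suc h b n))) same ⟩
      (sumFrom h b n +' fromℤ (+ h (b + + n)) *' pow (b + + n)) -' sumFrom h b n ≡⟨ cancel (sumFrom h b n) _ ⟩
      fromℤ (+ h (b + + n)) *' pow (b + + n)                         ∎)
      where
      open ≡-Reasoning
      cancel : ∀ s x → (s +' x) -' s ≡ x
      cancel = solve 2 (λ s x → (s ⊕ x) ⊕ ⊝ s ⊜ x) refl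

  -- Once equal, the sums stay equal, since switching between the two overshoots
  -- would need a digit difference θ^j(θ - 1); before that index they agree by
  -- uniqueness of greedy expansions.
  overshooting-expansions-agree : ∀ α g h b n₀ → Greedy g → Greedy h →
    (∀ i → i ℤ.< b → g i ≡ 0) → (∀ i → i ℤ.< b → h i ≡ 0) →
    OvershootsFrom α g b n₀ → OvershootsFrom α h b n₀ → sumFrom g b n₀ ≡ sumFrom h b n₀ → ∀ i → g i ≡ h i
  overshooting-expansions-agree α g h b n₀ greedy-g greedy-h g-below h-below g-over h-over same = agree
    where
    forward : ∀ u → sumFrom g b (u ℕ.+ n₀) ≡ sumFrom h b (u ℕ.+ n₀)
    forward zero    = same
    forward (suc u) = next-sums-agree α g h b (u ℕ.+ n₀) (g-over _ (ℕ.m≤n+m n₀ (suc u))) (h-over _ (ℕ.m≤n+m n₀ (suc u))) (forward u)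

    backward : ∀ v n → n ℕ.+ v ≡ n₀ → sumFrom g b n ≡ sumFrom h b n
    backward zero    n n+0≡n₀  = subst (λ k → sumFrom g b k ≡ sumFrom h b k) (sym (trans (sym (ℕ.+-identityʳ n)) n+0≡n₀)) same
    backward (suc v) n n+1+v≡n₀ = proj₂ (sumFrom-suc-injective g h greedy-g greedy-h b n (backward v (suc n) (trans (sym (ℕ.+-suc n v)) n+1+v≡n₀)))

    digit-agrees : ∀ n → g (b + + n) ≡ h (b + + n)
    digit-agrees n with n ℕ.<? n₀
    ... | yes n<n₀ = proj₁ (sumFrom-suc-injective g h greedy-g greedy-h b n (backward (n₀ ℕ.∸ suc n) (suc n) (ℕ.m+[n∸m]≡n n<n₀)))
    ... | no  n≮n₀ = subst (λ k → g (b + + k) ≡ h (b + + k)) (ℕ.m∸n+n≡m (ℕ.≮⇒≥ n≮n₀))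
                       (digit-from-sums g h b (n ℕ.∸ n₀ ℕ.+ n₀) (forward (n ℕ.∸ n₀)) (forward (suc (n ℕ.∸ n₀))))

    agree : ∀ i → g i ≡ h i
    agree i with i ℤ.<? b
    ... | yes i<b = trans (g-below i i<b) (sym (h-below i i<b))
    ... | no  i≮b = subst (λ k → g k ≡ h k) (trans (cong (ℤ._+_ b) (ℤ.0≤i⇒+∣i∣≡i (ℤ.i≤j⇒0≤j-i (ℤ.≮⇒≥ i≮b)))) (eq b i)) (digit-agrees ℤ.∣ i - b ∣)
      where
      eq : ∀ b i → b + (i - b) ≡ i
      eq = solve-∀

  sumFrom-lower-start : ∀ g st b d → (∀ i → i ℤ.< st → g i ≡ 0) → b + + d ≡ st → ∀ n → sumFrom g b (d ℕ.+ n) ≡ sumFrom g st n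
  sumFrom-lower-start g st b d g-below b+d≡st n = begin
    sumFrom g b (d ℕ.+ n)                        ≡⟨ sumFrom-+ g d b n ⟩
    sumFrom g b d +' sumFrom g (b + + d) n       ≡⟨ cong₂ _+'_ (sumFrom-zeros g b d zeros) (cong (λ i → sumFrom g i n) b+d≡st) ⟩
    0θ +' sumFrom g st n                         ≡⟨ +'-identityˡ _ ⟩
    sumFrom g st n                               ∎
    where
    open ≡-Reasoning
    zeros : ∀ j → j ℕ.< d → g (b + + j) ≡ 0
    zeros j j<d = g-below (b + + j) (subst (b + + j ℤ.<_) b+d≡st (ℤ.+-monoʳ-< b (+<+ j<d)))

  OvershootsFrom-lower-start : ∀ α g st b d n₀ → (∀ i → i ℤ.< st → g i ≡ 0) → b + + d ≡ st →
    OvershootsFrom α g st n₀ → OvershootsFrom α g b (d ℕ.+ n₀)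
  OvershootsFrom-lower-start α g st b d n₀ g-below b+d≡st over n d+n₀≤n =
    subst₂ (Overshoot α) index≡ (sym sum≡) (over n′ n₀≤n′)
    where
    d≤n : d ℕ.≤ n
    n′ : ℕ
    d≤n = ℕ.≤-trans (ℕ.m≤m+n d n₀) d+n₀≤n
    n′ = n ℕ.∸ d
    d+n′≡n : d ℕ.+ n′ ≡ n
    d+n′≡n = ℕ.m+[n∸m]≡n d≤n
    n₀≤n′ : n₀ ℕ.≤ n′
    n₀≤n′ = ℕ.+-cancelˡ-≤ d n₀ n′ (subst (d ℕ.+ n₀ ℕ.≤_) (sym d+n′≡n) d+n₀≤n)
    sum≡ : sumFrom g b n ≡ sumFrom g st n′
    sum≡ = trans (cong (sumFrom g b) (sym d+n′≡n)) (sumFrom-lower-start g st b d g-below b+d≡st n′)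
    index≡ : st + + n′ ≡ b + + n
    index≡ = trans (cong (_+ + n′) (sym b+d≡st)) (trans (ℤ.+-assoc b (+ d) (+ n′)) (cong (λ k → b + + k) d+n′≡n))

  OvershootsFrom-mono : ∀ α g b {n₀ n₁} → n₀ ℕ.≤ n₁ → OvershootsFrom α g b n₀ → OvershootsFrom α g b n₁
  OvershootsFrom-mono α g b n₀≤n₁ over n n₁≤n = over n (ℕ.≤-trans n₀≤n₁ n₁≤n)

module TwoExpansions (a : ℕ) (1≤a : 1 ℕ.≤ a) (α : Zθ) (α-negative : Negative a α) where
  open QuadraticIntegers a
  open Positivity a 1≤a
  open GreedySums a 1≤a
  open Existence a 1≤a
  open Uniqueness a 1≤a

  α<0 : Positive (-' α)
  α<0 = Negative⇒Positive-neg α α-negative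

  J₀ : ℤ
  J₀ = + proj₁ (archimedean (-' α))

  α+θ^J₀>0 : Positive (α +' pow J₀)
  α+θ^J₀>0 = positive-as (regroup α (pow J₀)) (proj₁ (proj₂ (archimedean (-' α))))
    where
    regroup : ∀ α p → α +' p ≡ p -' -' α
    regroup = solve 2 (λ α p → α ⊕ p ⊜ (p ⊕ ⊝ (⊝ α))) refl

  α+θ^[J₀+1]>0 : Positive (α +' pow (J₀ + + 1))
  α+θ^[J₀+1]>0 = positive-as (regroup α (pow J₀) (pow (J₀ + + 1))) (NonNegative-+-Positive (pow-mono J₀ 1) α+θ^J₀>0)
    where
    regroup : ∀ α p p′ → α +' p′ ≡ (p′ -' p) +' (α +' p)
    regroup = solve 3 (λ α p p′ → α ⊕ p′ ⊜ ((p′ ⊕ ⊝ p) ⊕ (α ⊕ p))) refl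

  module E₁ = GreedyExpansion α α<0 J₀ α+θ^J₀>0
  module E₂ = GreedyExpansion α α<0 (J₀ + + 1) α+θ^[J₀+1]>0

  α₁ α₂ : GLS a
  α₁ = E₁.series
  α₂ = E₂.series

  α₁≢α₂ : ¬ SameSeries α₁ α₂
  α₁≢α₂ same = a≢0 (begin
    a                                 ≡⟨ E₁.coefficient-tail 1 ⟨
    E₁.coefficient (J₀ + + 1)          ≡⟨ same (J₀ + + 1) ⟩
    E₂.coefficient (J₀ + + 1)          ≡⟨ cong E₂.coefficient (ℤ.+-identityʳ (J₀ + + 1)) ⟨
    E₂.coefficient (J₀ + + 1 + + 0)    ≡⟨ E₂.coefficient-tail 0 ⟩
    0                                 ∎)
    where open ≡-Reasoning

  -- All three sums eventually overshoot α by θ^j or θ^(j-1) at a common base b;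
  -- α₁ and α₂ never agree, so y agrees with one of them.
  α₁-or-α₂ : ∀ y → InClass y α → SameSeries y α₁ ⊎ SameSeries y α₂
  α₁-or-α₂ y y∈α = decide (over-y n ℕ.≤-refl) (over₁ n ℕ.≤-refl) (over₂ n ℕ.≤-refl)
    where
    b : ℤ
    b = (start y ⊓ E₁.lowest) ⊓ E₂.lowest
    b≤y : b ℤ.≤ start y
    b≤y = ℤ.≤-trans (ℤ.i⊓j≤i _ _) (ℤ.i⊓j≤i _ _)
    b≤₁ : b ℤ.≤ E₁.lowest
    b≤₁ = ℤ.≤-trans (ℤ.i⊓j≤i _ _) (ℤ.i⊓j≤j _ _)
    b≤₂ : b ℤ.≤ E₂.lowest
    b≤₂ = ℤ.i⊓j≤j _ _
    b+∣st-b∣≡st : ∀ st → b ℤ.≤ st → b + + ℤ.∣ st - b ∣ ≡ st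
    b+∣st-b∣≡st st b≤st = trans (cong (ℤ._+_ b) (ℤ.0≤i⇒+∣i∣≡i (ℤ.i≤j⇒0≤j-i b≤st))) (eq b st)
      where
      eq : ∀ b st → b + (st - b) ≡ st
      eq = solve-∀
    below-b : ∀ g st → b ℤ.≤ st → (∀ i → i ℤ.< st → g i ≡ 0) → ∀ i → i ℤ.< b → g i ≡ 0
    below-b g st b≤st g-below i i<b = g-below i (ℤ.<-≤-trans i<b b≤st)
    from-b : ∀ g st n₀ → b ℤ.≤ st → (∀ i → i ℤ.< st → g i ≡ 0) → OvershootsFrom α g st n₀ → OvershootsFrom α g b (ℤ.∣ st - b ∣ ℕ.+ n₀)
    from-b g st n₀ b≤st g-below = OvershootsFrom-lower-start α g st b _ n₀ g-below (b+∣st-b∣≡st st b≤st)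
    y-overshoots : ∃[ n₀ ] OvershootsFrom α (coeff y) (start y) n₀
    n-y n₁ n₂ n : ℕ
    y-overshoots = eventually-overshoots α α<0 y y∈α
    n-y = ℤ.∣ start y - b ∣ ℕ.+ proj₁ y-overshoots
    n₁ = ℤ.∣ E₁.lowest - b ∣ ℕ.+ E₁.stop
    n₂ = ℤ.∣ E₂.lowest - b ∣ ℕ.+ E₂.stop
    n = n-y ℕ.+ (n₁ ℕ.+ n₂)
    over-y : OvershootsFrom α (coeff y) b n
    over-y = OvershootsFrom-mono α (coeff y) b (ℕ.m≤m+n n-y _) (from-b (coeff y) (start y) _ b≤y (below y) (proj₂ y-overshoots))
    over₁ : OvershootsFrom α E₁.coefficient b n
    over₁ = OvershootsFrom-mono α E₁.coefficient b (ℕ.≤-trans (ℕ.m≤m+n n₁ n₂) (ℕ.m≤n+m _ n-y)) (from-b E₁.coefficient E₁.lowest E₁.stop b≤₁ E₁.coefficient-below E₁.overshoot)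
    over₂ : OvershootsFrom α E₂.coefficient b n
    over₂ = OvershootsFrom-mono α E₂.coefficient b (ℕ.≤-trans (ℕ.m≤n+m n₂ n₁) (ℕ.m≤n+m _ n-y)) (from-b E₂.coefficient E₂.lowest E₂.stop b≤₂ E₂.coefficient-below E₂.overshoot)
    y≡α₁ : sumFrom (coeff y) b n ≡ sumFrom E₁.coefficient b n → SameSeries y α₁
    y≡α₁ = overshooting-expansions-agree α (coeff y) E₁.coefficient b n (digit y , greedy y) E₁.coefficient-greedy
             (below-b (coeff y) (start y) b≤y (below y)) (below-b E₁.coefficient E₁.lowest b≤₁ E₁.coefficient-below) over-y over₁
    y≡α₂ : sumFrom (coeff y) b n ≡ sumFrom E₂.coefficient b n → SameSeries y α₂
    y≡α₂ = overshooting-expansions-agree α (coeff y) E₂.coefficient b n (digit y , greedy y) E₂.coefficient-greedy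
             (below-b (coeff y) (start y) b≤y (below y)) (below-b E₂.coefficient E₂.lowest b≤₂ E₂.coefficient-below) over-y over₂
    α₁≢α₂-at-n : sumFrom E₁.coefficient b n ≢ sumFrom E₂.coefficient b n
    α₁≢α₂-at-n same = α₁≢α₂ (overshooting-expansions-agree α E₁.coefficient E₂.coefficient b n E₁.coefficient-greedy E₂.coefficient-greedy
                        (below-b E₁.coefficient E₁.lowest b≤₁ E₁.coefficient-below) (below-b E₂.coefficient E₂.lowest b≤₂ E₂.coefficient-below) over₁ over₂ same)
    decide : Overshoot α (b + + n) (sumFrom (coeff y) b n) → Overshoot α (b + + n) (sumFrom E₁.coefficient b n) →
             Overshoot α (b + + n) (sumFrom E₂.coefficient b n) → SameSeries y α₁ ⊎ SameSeries y α₂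
    decide (inj₁ y≡) (inj₁ α₁≡) _          = inj₁ (y≡α₁ (trans y≡ (sym α₁≡)))
    decide (inj₂ y≡) (inj₂ α₁≡) _          = inj₁ (y≡α₁ (trans y≡ (sym α₁≡)))
    decide (inj₁ y≡) (inj₂ _)   (inj₁ α₂≡) = inj₂ (y≡α₂ (trans y≡ (sym α₂≡)))
    decide (inj₂ y≡) (inj₁ _)   (inj₂ α₂≡) = inj₂ (y≡α₂ (trans y≡ (sym α₂≡)))
    decide (inj₁ _)  (inj₂ α₁≡) (inj₂ α₂≡) = ⊥-elim (α₁≢α₂-at-n (trans α₁≡ (sym α₂≡)))
    decide (inj₂ _)  (inj₁ α₁≡) (inj₁ α₂≡) = ⊥-elim (α₁≢α₂-at-n (trans α₁≡ (sym α₂≡)))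

theorem24 : (a : ℕ) → 1 ≤ a → (α : Zθ) → Negative a α →
    Σ (GLS a) λ α₁ → Σ (GLS a) λ α₂ →
      InClass α₁ α × InClass α₂ α × ¬ SameSeries α₁ α₂ ×
      (∀ (y : GLS a) → InClass y α → SameSeries y α₁ ⊎ SameSeries y α₂)
theorem24 a 1≤a α α-negative = α₁ , α₂ , E₁.inClass , E₂.inClass , α₁≢α₂ , α₁-or-α₂
  where open TwoExpansions a 1≤a α α-negative
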